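{- Let $\mathbb{F}_q$ be a finite field of odd characteristic $p\ge5$ and let $A$ be an Alltop function on $\mathbb{F}_q$. For $a,b\in\mathbb{F}_q$ let $\vec v_{ab}\in\mathbb{C}^q$ be the vector with coordinates indexed by $x\in\mathbb{F}_q$ given by $\vec v_{ab}=\frac{1}{\sqrt q}\big(\omega_p^{\mathrm{tr}(A(x+a)+b(x+a))}\big)_{x\in\mathbb{F}_q}$, where $\omega_p=e^{2\pi i/p}$ and $\mathrm{tr}$ is the absolute trace $\mathbb{F}_q\to\mathbb{F}_p$, and let $V_a=\{\vec v_{ab}:b\in\mathbb{F}_q\}$. Then the standard basis $E$ of $\mathbb{C}^q$ together with the sets $V_a$, $a\in\mathbb{F}_q$, form a complete set of $q+1$ mutually unbiased bases in $\mathbb{C}^q$.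
   Context: For $f:\mathbb{F}_q\to\mathbb{F}_q$ and $a\in\mathbb{F}_q$ put $\Delta_{f,a}(x)=f(x+a)-f(x)$. A function $f$ is planar if $\Delta_{f,a}$ is a bijection for every $a\in\mathbb{F}_q^*$; $A$ is an Alltop function if $\Delta_{A,a}$ is planar for every $a\in\mathbb{F}_q^*$. Two orthonormal bases $B_1,B_2$ of $\mathbb{C}^d$ are unbiased if $|\langle\vec x|\vec y\rangle|=1/\sqrt d$ for all $\vec x\in B_1$, $\vec y\in B_2$; a set of pairwise unbiased orthonormal bases is a set of mutually unbiased bases. -}

module Defs where

open import Data.Nat as ℕ using (ℕ; zero; suc; NonZero; _^_)
open import Data.Nat.DivMod using (_%_; m%n<n)
open import Data.Fin as Fin using (Fin; toℕ; fromℕ<)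
open import Data.Integer as ℤ using (ℤ)
open import Data.List using (List; foldr; map)
open import Data.List.Base using (allFin)
open import Data.Maybe using (Maybe; just; nothing)
open import Data.Product using (∃; _×_)
open import Relation.Binary.PropositionalEquality using (_≡_; _≢_)
open import Relation.Nullary using (yes; no)
open import Relation.Binary.Definitions using (DecidableEquality)
open import Algebra.Core using (Op₁; Op₂)
open import Algebra.Structures using (IsCommutativeRing)
open import Function.Bundles using (_↔_; Inverse)
open import Function.Definitions using (Bijective)

record FiniteField : Set₁ where
  infixl 7 _*_
  infixl 6 _+_
  field
    F                 : Set
    _+_ _*_           : Op₂ F
    -_                : Op₁ F
    0# 1#             : F
    isCommutativeRing : IsCommutativeRing _≡_ _+_ _*_ -_ 0# 1#
    0≢1               : 0# ≢ 1#
    inverse           : ∀ x → x ≢ 0# → ∃ λ y → x * y ≡ 1#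
    _≟_               : DecidableEquality F
    size              : ℕ
    enum              : Fin size ↔ F

-- The ring ℤ[ω_p] ⊂ ℂ, ω_p = e^{2πi/p}, p prime.
-- An element is a coefficient vector c : Fin p → ℤ standing for
-- Σ_k c k · ω_p^k.  Since the minimal polynomial of ω_p is
-- 1 + x + … + x^{p-1}, two coefficient vectors denote the same complex
-- number iff their difference is a constant vector.

module Cyclotomic (p : ℕ) {{_ : NonZero p}} where

  Cyc : Set
  Cyc = Fin p → ℤ

  idx : ℕ → Fin p
  idx n = fromℕ< (m%n<n n p)

  _≈_ : Cyc → Cyc → Set
  a ≈ b = ∃ λ (c : ℤ) → ∀ k → a k ℤ.- b k ≡ c

  0c : Cyc
  0c k = ℤ.0ℤ

  ι : ℤ → Cyc
  ι n k with toℕ k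
  ... | zero  = n
  ... | suc _ = ℤ.0ℤ

  _⊕_ : Cyc → Cyc → Cyc
  (a ⊕ b) k = a k ℤ.+ b k

  sumFin : (n : ℕ) → (Fin n → ℤ) → ℤ
  sumFin n f = foldr ℤ._+_ ℤ.0ℤ (map f (allFin n))

  -- multiplication: ω^i · ω^j = ω^{i+j mod p}
  _⊛_ : Cyc → Cyc → Cyc
  (a ⊛ b) k = sumFin p (λ i → a i ℤ.* b (idx (toℕ k ℕ.+ (p ℕ.∸ toℕ i))))

  -- complex conjugation: ω^k ↦ ω^{-k}
  conj : Cyc → Cyc
  conj a k = a (idx (p ℕ.∸ toℕ k))

  norm² : Cyc → Cyc
  norm² z = z ⊛ conj z

module FF (𝔽 : FiniteField) where
  open FiniteField 𝔽

  _·1 : ℕ → F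
  zero  ·1 = 0#
  suc n ·1 = 1# + (n ·1)

  pow : F → ℕ → F
  pow x zero    = 1#
  pow x (suc n) = x * pow x n

  sumℕ : ℕ → (ℕ → F) → F
  sumℕ zero    f = 0#
  sumℕ (suc m) f = sumℕ m f + f m

  trace : (p m : ℕ) → F → F
  trace p m y = sumℕ m (λ i → pow y (p ^ i))

  Δ : (F → F) → F → F → F
  Δ f a x = f (x + a) + (- f x)

  Planar : (F → F) → Set
  Planar f = ∀ a → a ≢ 0# → Bijective _≡_ _≡_ (Δ f a)

  Alltop : (F → F) → Set
  Alltop A = ∀ a → a ≢ 0# → Planar (Δ A a)

  elements : List F
  elements = map (Inverse.to enum) (allFin size)

  module Vectors (p m : ℕ) {{_ : NonZero p}} where
    open Cyclotomic p public

    q : ℕ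
    q = size

    -- ω_p^{tr y}: the coefficient vector with a 1 in the position k
    -- with k·1 = tr y in F (exactly one such k < p exists).
    ωtr : F → Cyc
    ωtr y k with (toℕ k ·1) ≟ trace p m y
    ... | yes _ = ℤ.1ℤ
    ... | no  _ = ℤ.0ℤ

    CVec : Set
    CVec = F → Cyc

    sumF : (F → Cyc) → Cyc
    sumF f = foldr _⊕_ 0c (map f elements)

    ⟨_∣_⟩ : CVec → CVec → Cyc
    ⟨ u ∣ w ⟩ = sumF (λ x → conj (u x) ⊛ w x)

    -- A family of q vectors (indexed by F) q^{-scale/2} · vec i.
    record ScaledFamily : Set where
      constructor ⟪_,_⟫
      field
        scale : ℕ
        vec   : F → CVec

    open ScaledFamily

    qℤ : ℕ → Cyc
    qℤ n = ι (ℤ.+ (q ^ n))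

    -- orthonormal: ⟨q^{-s/2}u_i | q^{-s/2}u_j⟩ = δ_ij.
    -- (q orthonormal vectors in ℂ^q form an orthonormal basis.)
    OrthonormalBasis : ScaledFamily → Set
    OrthonormalBasis B =
      (∀ i → ⟨ vec B i ∣ vec B i ⟩ ≈ qℤ (scale B)) ×
      (∀ i j → i ≢ j → ⟨ vec B i ∣ vec B j ⟩ ≈ 0c)

    -- unbiased: |⟨q^{-s/2}u | q^{-t/2}w⟩|² = 1/q,
    -- i.e.  q · |⟨u|w⟩|² = q^{s+t}.
    Unbiased : ScaledFamily → ScaledFamily → Set
    Unbiased B C = ∀ i j →
      (qℤ 1 ⊛ norm² ⟨ vec B i ∣ vec C j ⟩) ≈ qℤ (scale B ℕ.+ scale C)

    E : ScaledFamily
    E = ⟪ 0 , (λ y x → δ y x) ⟫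
      where
      δ : F → F → Cyc
      δ y x with x ≟ y
      ... | yes _ = ι ℤ.1ℤ
      ... | no  _ = 0c

    V : (F → F) → F → ScaledFamily
    V A a = ⟪ 1 , (λ b x → ωtr (A (x + a) + b * (x + a))) ⟫

    Family : (F → F) → Maybe F → ScaledFamily
    Family A nothing  = E
    Family A (just a) = V A a

-- Write ψ(y) = ω_p^(tr y). The trace is additive, takes values in the prime field (it is fixed
-- by the Frobenius map) and is not identically zero (it is a polynomial of degree p^(m-1) < q),
-- so ψ is a nontrivial additive character and ∑_x ψ(g x) = 0 for every bijection g of 𝔽_q.
-- Up to the factor 1/q, ⟨v_ab | v_a'b'⟩ is ∑_x ψ(G x) with G the difference of the two
-- exponents, and |∑_x ψ(G x)|² = ∑_d ∑_y ψ(G(y + d) - G y) equals q whenever G is planar.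
-- For a = a' and b ≠ b', G is a nonconstant affine map, which gives orthogonality; for a ≠ a',
-- Δ_{G,d} is Δ_{Δ_{A,a'-a},d} up to translations, hence bijective because A is Alltop.
-- Inner products with the standard basis are single values of ψ, of modulus 1.

module Submission where

open import Defs
open import Algebra.Bundles using (CommutativeRing; CommutativeMonoid)
open import Algebra.Solver.Ring.AlmostCommutativeRing
  using (AlmostCommutativeRing; fromCommutativeRing; _-Raw-AlmostCommutative⟶_)
open import Data.Fin as Fin using (Fin; zero; suc; toℕ)
import Data.Fin.Properties as Fin
open import Data.List using (List; []; _∷_; foldr; map; allFin; tabulate; length)
open import Data.List.Relation.Unary.All using (All; []; _∷_)
import Data.List.Relation.Unary.All as All
import Data.List.Relation.Unary.All.Properties as All
import Data.List.Relation.Unary.Any as Any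
import Data.List.Relation.Unary.Unique.Propositional.Properties as Unique
open import Data.List.Relation.Unary.AllPairs using ([]; _∷_)
open import Data.List.Relation.Unary.Unique.Propositional using (Unique)
import Data.List.Properties as List
open import Data.Empty using (⊥-elim)
import Data.Sign as Sign
open import Data.Integer as ℤ using (ℤ; -[1+_]; +[1+_])
import Data.Integer.Properties as ℤ
open import Data.Integer.Solver using () renaming (module +-*-Solver to ℤSolver)
open import Data.Nat.Solver using () renaming (module +-*-Solver to ℕSolver)
open import Data.Maybe using (Maybe; just; nothing)
open import Data.Nat as ℕ using (ℕ; zero; suc; NonZero; _<_; _≤_; z≤n; s≤s; _∸_; _^_; _!)
import Data.Nat.Properties as ℕ
open import Data.Nat.Combinatorics using (_C_; nCn≡1; k![n∸k]!∣n!)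
open import Data.Nat.Combinatorics.Specification using (nCk≡n!/k![n-k]!)
open import Data.Nat.Coprimality using (coprime-Bézout; prime⇒coprime)
open import Data.Nat.DivMod using (_%_; _/_; m%n<n; m≡m%n+[m/n]*n; m/n*n≡m; [m+kn]%n≡m%n; m<n⇒m%n≡m)
open import Data.Nat.Divisibility using (_∣_; divides; ∣⇒≤; m∣m*n; ∣1⇒≡1)
open import Data.Nat.GCD using (module Bézout)
open import Data.Nat.Primality using (Prime; euclidsLemma; ¬prime[1]; prime⇒nonZero; prime⇒nonTrivial)
open import Data.Product using (∃; _×_; _,_; proj₁; proj₂)
open import Data.Sum using (inj₁; inj₂)
open import Function using (_∘_; id; _↔_; Inverse; mk↔ₛ′)
open import Function.Bundles using (Bijection; mk⤖)
open import Function.Definitions using (Bijective)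
open import Function.Properties.Bijection using (⤖⇒↔)
open import Function.Properties.Inverse using (↔⇒⤖)
import Function.Construct.Composition as Comp
open import Function.Construct.Composition using (_↔-∘_)
open import Function.Construct.Symmetry using (↔-sym)
open import Relation.Binary.PropositionalEquality as ≡
  using (_≡_; _≢_; refl; sym; trans; cong; cong₂; subst; subst₂; module ≡-Reasoning)
open import Relation.Nullary using (yes; no; ¬_; ¬?)
open import Relation.Nullary.Decidable using (decidable-stable)
open import Relation.Binary.Definitions using (tri<; tri≈; tri>)

module Sums {c ℓ} (M : CommutativeMonoid c ℓ) where
  open CommutativeMonoid M hiding (refl; sym; trans)
  module M = CommutativeMonoid M
  open import Algebra.Properties.CommutativeMonoid.Sum M
    using (sum; sum-remove; ∑-distrib-+; sum-permute; sum-cong-≗) renaming (∑-comm to sum-comm)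
  open import Data.Vec.Functional using (removeAt)
  open import Relation.Binary.Reasoning.Setoid setoid

  sumₗ : {A : Set} → (A → Carrier) → List A → Carrier
  sumₗ f xs = foldr _∙_ ε (map f xs)

  sumₗ-cong : {A : Set} {f g : A → Carrier} (xs : List A) → (∀ x → f x ≈ g x) → sumₗ f xs ≈ sumₗ g xs
  sumₗ-cong []       f≈g = M.refl
  sumₗ-cong (x ∷ xs) f≈g = ∙-cong (f≈g x) (sumₗ-cong xs f≈g)

  sumₗ-allFin : ∀ n (f : Fin n → Carrier) → sumₗ f (allFin n) ≡ sum f
  sumₗ-allFin n f = trans (cong (foldr _∙_ ε) (List.map-tabulate id f)) (foldr-tabulate n)
    where
    foldr-tabulate : ∀ n {f : Fin n → Carrier} → foldr _∙_ ε (tabulate f) ≡ sum f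
    foldr-tabulate zero    = refl
    foldr-tabulate (suc n) = cong (_ ∙_) (foldr-tabulate n)

  sum-zero : ∀ n (f : Fin n → Carrier) → (∀ i → f i ≈ ε) → sum f ≈ ε
  sum-zero zero    f f≈ε = M.refl
  sum-zero (suc n) f f≈ε = M.trans (∙-cong (f≈ε zero) (sum-zero n (f ∘ suc) (f≈ε ∘ suc))) (identityˡ ε)

  sum-δ : ∀ n (f : Fin n → Carrier) (s : Fin n) → (∀ i → i ≢ s → f i ≈ ε) → sum f ≈ f s
  sum-δ (suc n) f s f≈ε = begin
    sum f                      ≈⟨ sum-remove f ⟩
    f s ∙ sum (removeAt f s)   ≈⟨ ∙-congˡ (sum-zero n _ (λ i → f≈ε _ (Fin.punchInᵢ≢i s i))) ⟩
    f s ∙ ε                    ≈⟨ identityʳ _ ⟩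
    f s                        ∎

  module Enumerated {A : Set} {n : ℕ} (enum : Fin n ↔ A) where
    open Inverse enum

    ∑ : (A → Carrier) → Carrier
    ∑ f = sumₗ f (map to (allFin n))

    ∑≡sum : ∀ f → ∑ f ≡ sum (f ∘ to)
    ∑≡sum f = trans (cong (foldr _∙_ ε) (sym (List.map-∘ (allFin n)))) (sumₗ-allFin n (f ∘ to))

    ∑-cong : ∀ {f g} → (∀ x → f x ≈ g x) → ∑ f ≈ ∑ g
    ∑-cong f≈g = sumₗ-cong (map to (allFin n)) f≈g

    ∑-distrib : ∀ f g → ∑ (λ x → f x ∙ g x) ≈ ∑ f ∙ ∑ g
    ∑-distrib f g = begin
      ∑ (λ x → f x ∙ g x)              ≡⟨ ∑≡sum _ ⟩
      sum (λ i → f (to i) ∙ g (to i))  ≈⟨ ∑-distrib-+ (f ∘ to) (g ∘ to) ⟩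
      sum (f ∘ to) ∙ sum (g ∘ to)      ≡⟨ cong₂ _∙_ (∑≡sum f) (∑≡sum g) ⟨
      ∑ f ∙ ∑ g                        ∎

    ∑-δ : ∀ f y → (∀ x → x ≢ y → f x ≈ ε) → ∑ f ≈ f y
    ∑-δ f y f≈ε = begin
      ∑ f               ≡⟨ ∑≡sum f ⟩
      sum (f ∘ to)      ≈⟨ sum-δ n (f ∘ to) (from y) (λ i i≢ → f≈ε (to i) (i≢ ∘ to⇒from≡)) ⟩
      f (to (from y))   ≡⟨ cong f (strictlyInverseˡ y) ⟩
      f y               ∎
      where
      to⇒from≡ : ∀ {i} → to i ≡ y → i ≡ from y
      to⇒from≡ {i} refl = sym (strictlyInverseʳ i)

    ∑-comm : ∀ (f : A → A → Carrier) → ∑ (λ x → ∑ (f x)) ≈ ∑ (λ y → ∑ (λ x → f x y))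
    ∑-comm f = begin
      ∑ (λ x → ∑ (f x))                        ≈⟨ ∑-cong (λ x → reflexive (∑≡sum (f x))) ⟩
      ∑ (λ x → sum (f x ∘ to))                 ≡⟨ ∑≡sum _ ⟩
      sum (λ i → sum (λ j → f (to i) (to j)))  ≈⟨ sum-comm (λ i j → f (to i) (to j)) ⟩
      sum (λ j → sum (λ i → f (to i) (to j)))  ≡⟨ ∑≡sum _ ⟨
      ∑ (λ y → sum (λ i → f (to i) y))         ≈⟨ ∑-cong (λ y → reflexive (∑≡sum (λ x → f x y))) ⟨
      ∑ (λ y → ∑ (λ x → f x y))                ∎

    ∑-reindex : ∀ f (π : A ↔ A) → ∑ (f ∘ Inverse.to π) ≈ ∑ f
    ∑-reindex f π = begin
      ∑ (f ∘ π.to)             ≡⟨ ∑≡sum _ ⟩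
      sum (f ∘ π.to ∘ to)      ≡⟨ sum-cong-≗ (λ i → cong f (strictlyInverseˡ (π.to (to i)))) ⟨
      sum (f ∘ to ∘ σ.to)      ≈⟨ sum-permute (f ∘ to) σ ⟨
      sum (f ∘ to)             ≡⟨ ∑≡sum f ⟨
      ∑ f                      ∎
      where
      module π = Inverse π
      σ : Fin n ↔ Fin n
      σ = ↔-sym enum ↔-∘ (π ↔-∘ enum)
      module σ = Inverse σ

module _ {p : ℕ} (p-prime : Prime p) where

  prime∤! : ∀ {j} → j < p → ¬ (p ∣ j !)
  prime∤! {zero}  _   p∣1 = ¬prime[1] (subst Prime (∣1⇒≡1 p∣1) p-prime)
  prime∤! {suc j} j<p p∣j! with euclidsLemma (suc j) (j !) p-prime p∣j!
  ... | inj₁ p∣1+j = ℕ.<-irrefl refl (ℕ.<-≤-trans j<p (∣⇒≤ p∣1+j))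
  ... | inj₂ p∣j!  = prime∤! (ℕ.<-trans (ℕ.n<1+n j) j<p) p∣j!

  prime∣choose : ∀ {k} → 0 < k → k < p → p ∣ p C k
  prime∣choose {k} 0<k k<p with euclidsLemma (p C k) (k ! ℕ.* (p ∸ k) !) p-prime p∣C·k!·[p∸k]!
    where
    instance _ = k ℕ.!* (p ∸ k) !≢0
    p∣C·k!·[p∸k]! : p ∣ (p C k) ℕ.* (k ! ℕ.* (p ∸ k) !)
    p∣C·k!·[p∸k]! = subst (p ∣_)
      (sym (trans (cong (ℕ._* (k ! ℕ.* (p ∸ k) !)) (nCk≡n!/k![n-k]! (ℕ.<⇒≤ k<p)))
                  (m/n*n≡m (k![n∸k]!∣n! (ℕ.<⇒≤ k<p)))))
      (p∣p! p {{prime⇒nonZero p-prime}})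
      where
      p∣p! : ∀ n .{{_ : NonZero n}} → n ∣ n !
      p∣p! (suc n) = m∣m*n (n !)
  ... | inj₁ p∣C = p∣C
  ... | inj₂ p∣k!·[p∸k]! with euclidsLemma (k !) ((p ∸ k) !) p-prime p∣k!·[p∸k]!
  ...   | inj₁ p∣k!     = ⊥-elim (prime∤! k<p p∣k!)
  ...   | inj₂ p∣[p∸k]! = ⊥-elim (prime∤! (ℕ.∸-monoʳ-< {p} {k} {0} 0<k (ℕ.<⇒≤ k<p)) p∣[p∸k]!)

module FieldRing (𝔽 : FiniteField) where
  open FiniteField 𝔽 public
  open FF 𝔽 public

  commutativeRing : CommutativeRing _ _
  commutativeRing = record { isCommutativeRing = isCommutativeRing }

  open CommutativeRing commutativeRing public
    using ( +-assoc; +-comm; *-assoc; *-comm; +-identityˡ; +-identityʳ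
          ; *-identityˡ; *-identityʳ; distribˡ; distribʳ; zeroˡ; zeroʳ
          ; -‿inverseˡ; -‿inverseʳ; ring; semiring; commutativeSemiring
          ; +-commutativeMonoid; *-commutativeMonoid)
  open import Algebra.Properties.Ring ring public
    using (-1*x≈-x; -‿involutive; -0#≈0#; -‿+-comm; +-inverseʳ-unique; +-cancelˡ; +-cancelʳ; -‿distribˡ-*; -‿distribʳ-*)
  open import Algebra.Properties.Semiring.Mult semiring using (×-homo-+; ×1-homo-*) renaming (_×_ to _×ₙ_)

  ·1≡×ₙ1# : ∀ n → n ·1 ≡ n ×ₙ 1#
  ·1≡×ₙ1# zero    = refl
  ·1≡×ₙ1# (suc n) = cong (1# +_) (·1≡×ₙ1# n)

  ·1-homo-+ : ∀ m n → (m ℕ.+ n) ·1 ≡ m ·1 + n ·1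
  ·1-homo-+ m n = trans (·1≡×ₙ1# (m ℕ.+ n)) (trans (×-homo-+ 1# m n) (sym (cong₂ _+_ (·1≡×ₙ1# m) (·1≡×ₙ1# n))))

  ·1-homo-* : ∀ m n → (m ℕ.* n) ·1 ≡ m ·1 * n ·1
  ·1-homo-* m n = trans (·1≡×ₙ1# (m ℕ.* n)) (trans (×1-homo-* m n) (sym (cong₂ _*_ (·1≡×ₙ1# m) (·1≡×ₙ1# n))))

  -- The canonical map ℤ → F; being a ring homomorphism, it lets Algebra.Solver.Ring work over F.
  ⟦_⟧ℤ : ℤ → F
  ⟦ ℤ.+ n    ⟧ℤ = n ·1
  ⟦ -[1+ n ] ⟧ℤ = - (suc n ·1)

  ⟦⊖⟧ : ∀ m n → ⟦ m ℤ.⊖ n ⟧ℤ ≡ m ·1 + - (n ·1)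
  ⟦⊖⟧ zero    zero    = sym (trans (cong (0# +_) -0#≈0#) (+-identityʳ 0#))
  ⟦⊖⟧ zero    (suc n) = sym (+-identityˡ _)
  ⟦⊖⟧ (suc m) zero    = sym (trans (cong (suc m ·1 +_) -0#≈0#) (+-identityʳ _))
  ⟦⊖⟧ (suc m) (suc n) = begin
    ⟦ suc m ℤ.⊖ suc n ⟧ℤ             ≡⟨ cong ⟦_⟧ℤ (ℤ.[1+m]⊖[1+n]≡m⊖n m n) ⟩
    ⟦ m ℤ.⊖ n ⟧ℤ                     ≡⟨ ⟦⊖⟧ m n ⟩
    m ·1 + - (n ·1)                  ≡⟨ cong (_+ - (n ·1)) (sym (+-identityˡ _)) ⟩
    (0# + m ·1) + - (n ·1)           ≡⟨ cong (λ z → (z + m ·1) + - (n ·1)) (sym (-‿inverseʳ 1#)) ⟩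
    ((1# + - 1#) + m ·1) + - (n ·1)  ≡⟨ cong (_+ - (n ·1)) (trans (+-assoc _ _ _) (cong (1# +_) (+-comm _ _))) ⟩
    (1# + (m ·1 + - 1#)) + - (n ·1)  ≡⟨ trans (cong (_+ - (n ·1)) (sym (+-assoc _ _ _))) (+-assoc _ _ _) ⟩
    suc m ·1 + (- 1# + - (n ·1))     ≡⟨ cong (suc m ·1 +_) (-‿+-comm 1# (n ·1)) ⟩
    suc m ·1 + - (suc n ·1)          ∎
    where open ≡-Reasoning

  ⟦⟧-homo-+ : ∀ i j → ⟦ i ℤ.+ j ⟧ℤ ≡ ⟦ i ⟧ℤ + ⟦ j ⟧ℤ
  ⟦⟧-homo-+ (ℤ.+ m)  (ℤ.+ n)  = ·1-homo-+ m n
  ⟦⟧-homo-+ (ℤ.+ m)  -[1+ n ] = ⟦⊖⟧ m (suc n)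
  ⟦⟧-homo-+ -[1+ m ] (ℤ.+ n)  = trans (⟦⊖⟧ n (suc m)) (+-comm _ _)
  ⟦⟧-homo-+ -[1+ m ] -[1+ n ] = begin
    - (suc (suc (m ℕ.+ n)) ·1)        ≡⟨ cong (λ k → - (suc k ·1)) (sym (ℕ.+-suc m n)) ⟩
    - ((suc m ℕ.+ suc n) ·1)          ≡⟨ cong -_ (·1-homo-+ (suc m) (suc n)) ⟩
    - (suc m ·1 + suc n ·1)           ≡⟨ sym (-‿+-comm _ _) ⟩
    - (suc m ·1) + - (suc n ·1)       ∎
    where open ≡-Reasoning

  ⟦⟧-homo-- : ∀ i → ⟦ ℤ.- i ⟧ℤ ≡ - ⟦ i ⟧ℤ
  ⟦⟧-homo-- (ℤ.+ zero) = sym -0#≈0#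
  ⟦⟧-homo-- +[1+ n ]   = refl
  ⟦⟧-homo-- -[1+ n ]   = sym (-‿involutive _)

  ⟦-◃⟧ : ∀ n → ⟦ Sign.- ℤ.◃ n ⟧ℤ ≡ - (n ·1)
  ⟦-◃⟧ n = trans (cong ⟦_⟧ℤ (ℤ.-◃n≡-n n)) (⟦⟧-homo-- (ℤ.+ n))

  ⟦⟧-homo-* : ∀ i j → ⟦ i ℤ.* j ⟧ℤ ≡ ⟦ i ⟧ℤ * ⟦ j ⟧ℤ
  ⟦⟧-homo-* (ℤ.+ m)  (ℤ.+ n)  = trans (cong ⟦_⟧ℤ (ℤ.+◃n≡+n (m ℕ.* n))) (·1-homo-* m n)
  ⟦⟧-homo-* (ℤ.+ m)  -[1+ n ] = trans (⟦-◃⟧ (m ℕ.* suc n)) (trans (cong -_ (·1-homo-* m (suc n))) (-‿distribʳ-* _ _))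
  ⟦⟧-homo-* -[1+ m ] (ℤ.+ n)  = trans (⟦-◃⟧ (suc m ℕ.* n)) (trans (cong -_ (·1-homo-* (suc m) n)) (-‿distribˡ-* _ _))
  ⟦⟧-homo-* -[1+ m ] -[1+ n ] = trans (cong ⟦_⟧ℤ (ℤ.+◃n≡+n (suc m ℕ.* suc n)))
    (trans (·1-homo-* (suc m) (suc n))
      (sym (trans (sym (-‿distribˡ-* _ _)) (trans (cong -_ (sym (-‿distribʳ-* _ _))) (-‿involutive _)))))

  private
    almostCommutativeRing : AlmostCommutativeRing _ _
    almostCommutativeRing = fromCommutativeRing commutativeRing

    ⟦⟧-morphism : ℤ.+-*-rawRing -Raw-AlmostCommutative⟶ almostCommutativeRing
    ⟦⟧-morphism = record
      { ⟦_⟧ = ⟦_⟧ℤ ; +-homo = ⟦⟧-homo-+ ; *-homo = ⟦⟧-homo-* ; -‿homo = ⟦⟧-homo--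
      ; 0-homo = refl ; 1-homo = +-identityʳ 1# }

    ⟦⟧-coeff? : ∀ i j → Maybe (⟦ i ⟧ℤ ≡ ⟦ j ⟧ℤ)
    ⟦⟧-coeff? i j with i ℤ.≟ j
    ... | yes i≡j = just (cong ⟦_⟧ℤ i≡j)
    ... | no _    = nothing

  open import Algebra.Solver.Ring ℤ.+-*-rawRing almostCommutativeRing ⟦⟧-morphism ⟦⟧-coeff? public
    using (solve; _:=_; _:+_; _:*_; :-_; con)

  pow-+ : ∀ x a b → pow x (a ℕ.+ b) ≡ pow x a * pow x b
  pow-+ x zero    b = sym (*-identityˡ _)
  pow-+ x (suc a) b = trans (cong (x *_) (pow-+ x a b)) (sym (*-assoc _ _ _))

  pow-* : ∀ x a b → pow x (a ℕ.* b) ≡ pow (pow x b) a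
  pow-* x zero    b = refl
  pow-* x (suc a) b = trans (pow-+ x b (a ℕ.* b)) (cong (pow x b *_) (pow-* x a b))

  pow-1 : ∀ n → pow 1# n ≡ 1#
  pow-1 zero    = refl
  pow-1 (suc n) = trans (*-identityˡ _) (pow-1 n)

  pow-0 : ∀ n → .{{NonZero n}} → pow 0# n ≡ 0#
  pow-0 (suc n) = zeroˡ _

  1·1≡1# : 1 ·1 ≡ 1#
  1·1≡1# = +-identityʳ 1#

  ×ₙ≡·1* : ∀ n z → n ×ₙ z ≡ n ·1 * z
  ×ₙ≡·1* zero    z = sym (zeroˡ z)
  ×ₙ≡·1* (suc n) z = trans (cong (z +_) (×ₙ≡·1* n z))
    (sym (trans (distribʳ z 1# (n ·1)) (cong (_+ n ·1 * z) (*-identityˡ z))))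

  open import Algebra.Properties.Semiring.Exp semiring using () renaming (_^_ to _^ᵣ_)
  open import Algebra.Properties.CommutativeSemiring.Binomial commutativeSemiring
    using (theorem; binomial; binomialTerm)
  open import Algebra.Properties.CommutativeMonoid.Sum +-commutativeMonoid using (sum)
  open Sums +-commutativeMonoid using (sum-δ)

  pow≡^ᵣ : ∀ x n → pow x n ≡ x ^ᵣ n
  pow≡^ᵣ x zero    = refl
  pow≡^ᵣ x (suc n) = cong (x *_) (pow≡^ᵣ x n)

  binomialTerm-0 : ∀ x y n → binomialTerm x y n zero ≡ pow y n
  binomialTerm-0 x y n = begin
    binomialTerm x y n zero    ≡⟨ ×ₙ≡·1* (n C 0) (binomial x y n zero) ⟩
    1 ·1 * (1# * y ^ᵣ n)       ≡⟨ cong₂ _*_ 1·1≡1# (*-identityˡ _) ⟩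
    1# * y ^ᵣ n                ≡⟨ *-identityˡ _ ⟩
    y ^ᵣ n                     ≡⟨ pow≡^ᵣ y n ⟨
    pow y n                    ∎
    where open ≡-Reasoning

  binomialTerm-top : ∀ x y n → binomialTerm x y n (Fin.fromℕ n) ≡ pow x n
  binomialTerm-top x y n = begin
    binomialTerm x y n (Fin.fromℕ n)
      ≡⟨ ×ₙ≡·1* (n C toℕ (Fin.fromℕ n)) (binomial x y n (Fin.fromℕ n)) ⟩
    (n C toℕ (Fin.fromℕ n)) ·1 * binomial x y n (Fin.fromℕ n)
      ≡⟨ cong (λ t → (n C t) ·1 * (x ^ᵣ t * y ^ᵣ (n ∸ t))) (Fin.toℕ-fromℕ n) ⟩
    (n C n) ·1 * (x ^ᵣ n * y ^ᵣ (n ∸ n))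
      ≡⟨ cong₂ (λ c e → c ·1 * (x ^ᵣ n * y ^ᵣ e)) (nCn≡1 n) (ℕ.n∸n≡0 n) ⟩
    1 ·1 * (x ^ᵣ n * 1#)
      ≡⟨ cong₂ _*_ 1·1≡1# (*-identityʳ _) ⟩
    1# * x ^ᵣ n
      ≡⟨ *-identityˡ _ ⟩
    x ^ᵣ n
      ≡⟨ pow≡^ᵣ x n ⟨
    pow x n ∎
    where open ≡-Reasoning

  inner-binomials≡0⇒pow-homo-+ : ∀ n → (∀ k → 0 < k → k < suc n → (suc n C k) ·1 ≡ 0#) →
                                 ∀ x y → pow (x + y) (suc n) ≡ pow x (suc n) + pow y (suc n)
  inner-binomials≡0⇒pow-homo-+ n C≡0 x y = begin
    pow (x + y) (suc n)                 ≡⟨ pow≡^ᵣ (x + y) (suc n) ⟩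
    (x + y) ^ᵣ suc n                    ≡⟨ theorem (suc n) x y ⟩
    term zero + sum (term ∘ suc)        ≡⟨ cong (term zero +_) (sum-δ (suc n) (term ∘ suc) (Fin.fromℕ n) inner≡0) ⟩
    term zero + term (Fin.fromℕ (suc n)) ≡⟨ cong₂ _+_ (binomialTerm-0 x y (suc n)) (binomialTerm-top x y (suc n)) ⟩
    pow y (suc n) + pow x (suc n)       ≡⟨ +-comm _ _ ⟩
    pow x (suc n) + pow y (suc n)       ∎
    where
    open ≡-Reasoning
    term : Fin (suc (suc n)) → F
    term = binomialTerm x y (suc n)
    inner≡0 : ∀ i → i ≢ Fin.fromℕ n → term (suc i) ≡ 0#
    inner≡0 i i≢n = begin
      term (suc i)
        ≡⟨ ×ₙ≡·1* (suc n C suc (toℕ i)) (binomial x y (suc n) (suc i)) ⟩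
      (suc n C suc (toℕ i)) ·1 * binomial x y (suc n) (suc i)
        ≡⟨ cong (_* binomial x y (suc n) (suc i)) (C≡0 (suc (toℕ i)) (s≤s z≤n) (s≤s i<n)) ⟩
      0# * binomial x y (suc n) (suc i)
        ≡⟨ zeroˡ _ ⟩
      0# ∎
      where
      i<n : toℕ i < n
      i<n = ℕ.≤∧≢⇒< (Fin.toℕ≤pred[n] i) (λ i≡n → i≢n (Fin.toℕ-injective (trans i≡n (sym (Fin.toℕ-fromℕ n)))))

  *-cancelˡ-0 : ∀ x y → x ≢ 0# → x * y ≡ 0# → y ≡ 0#
  *-cancelˡ-0 x y x≢0 xy≡0 with inverse x x≢0
  ... | x⁻¹ , xx⁻¹≡1 = begin
    y              ≡⟨ sym (*-identityˡ y) ⟩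
    1# * y         ≡⟨ cong (_* y) (sym xx⁻¹≡1) ⟩
    (x * x⁻¹) * y  ≡⟨ solve 3 (λ x x⁻¹ y → (x :* x⁻¹) :* y := x⁻¹ :* (x :* y)) refl x x⁻¹ y ⟩
    x⁻¹ * (x * y)  ≡⟨ cong (x⁻¹ *_) xy≡0 ⟩
    x⁻¹ * 0#       ≡⟨ zeroʳ x⁻¹ ⟩
    0#             ∎
    where open ≡-Reasoning

  x-y≡0⇒x≡y : ∀ x y → x + - y ≡ 0# → x ≡ y
  x-y≡0⇒x≡y x y x-y≡0 = begin
    x                  ≡⟨ solve 2 (λ x y → x := (x :+ :- y) :+ y) refl x y ⟩
    (x + - y) + y      ≡⟨ cong (_+ y) x-y≡0 ⟩
    0# + y             ≡⟨ +-identityˡ y ⟩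
    y                  ∎
    where open ≡-Reasoning

  +ˡ-↔ : F → F ↔ F
  +ˡ-↔ y = mk↔ₛ′ (y +_) (- y +_)
    (λ x → solve 2 (λ y x → y :+ (:- y :+ x) := x) refl y x)
    (λ x → solve 2 (λ y x → :- y :+ (y :+ x) := x) refl y x)

  +ʳ-↔ : F → F ↔ F
  +ʳ-↔ a = mk↔ₛ′ (_+ a) (_+ - a)
    (λ x → solve 2 (λ a x → (x :+ :- a) :+ a := x) refl a x)
    (λ x → solve 2 (λ a x → (x :+ a) :+ :- a := x) refl a x)

  *ˡ-↔ : ∀ {c} → c ≢ 0# → F ↔ F
  *ˡ-↔ {c} c≢0 with inverse c c≢0
  ... | c⁻¹ , cc⁻¹≡1 = mk↔ₛ′ (c *_) (c⁻¹ *_) (cancel c c⁻¹ cc⁻¹≡1) (cancel c⁻¹ c (trans (*-comm c⁻¹ c) cc⁻¹≡1))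
    where
    cancel : ∀ a b → a * b ≡ 1# → ∀ x → a * (b * x) ≡ x
    cancel a b ab≡1 x = trans (sym (*-assoc a b x)) (trans (cong (_* x) ab≡1) (*-identityˡ x))

  Bijective-cong : ∀ {f g : F → F} → (∀ x → f x ≡ g x) → Bijective _≡_ _≡_ f → Bijective _≡_ _≡_ g
  Bijective-cong {f} {g} f≗g (f-injective , f-surjective) =
    (λ {x} {y} gx≡gy → f-injective (trans (f≗g x) (trans gx≡gy (sym (f≗g y))))) ,
    (λ y → proj₁ (f-surjective y) , λ z≡x → trans (sym (f≗g _)) (proj₂ (f-surjective y) z≡x))

  affine-bijective : ∀ {h : F → F} a e → Bijective _≡_ _≡_ h → Bijective _≡_ _≡_ (λ x → h (x + a) + e)
  affine-bijective a e h-bijective =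
    Comp.bijective _≡_ _≡_ _≡_ (Comp.bijective _≡_ _≡_ _≡_ (Bijection.bijective (↔⇒⤖ (+ʳ-↔ a))) h-bijective)
                   (Bijection.bijective (↔⇒⤖ (+ʳ-↔ e)))

module PrimeCharacteristic (𝔽 : FiniteField) (p : ℕ) {{_ : NonZero p}} (p-prime : Prime p)
                           (char-p : FF._·1 𝔽 p ≡ FiniteField.0# 𝔽) where
  open FieldRing 𝔽

  1<p : 1 < p
  1<p = ℕ.nonTrivial⇒n>1 p {{prime⇒nonTrivial p-prime}}

  multiple·1≡0 : ∀ k → (k ℕ.* p) ·1 ≡ 0#
  multiple·1≡0 k = trans (·1-homo-* k p) (trans (cong (k ·1 *_) char-p) (zeroʳ _))

  ·1≡%·1 : ∀ n → n ·1 ≡ (n % p) ·1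
  ·1≡%·1 n = begin
    n ·1                                ≡⟨ cong _·1 (m≡m%n+[m/n]*n n p) ⟩
    (n % p ℕ.+ (n / p) ℕ.* p) ·1        ≡⟨ ·1-homo-+ (n % p) _ ⟩
    (n % p) ·1 + ((n / p) ℕ.* p) ·1     ≡⟨ cong ((n % p) ·1 +_) (multiple·1≡0 (n / p)) ⟩
    (n % p) ·1 + 0#                     ≡⟨ +-identityʳ _ ⟩
    (n % p) ·1                          ∎
    where open ≡-Reasoning

  [p∸n]·1≡-n·1 : ∀ n → n ≤ p → (p ∸ n) ·1 ≡ - (n ·1)
  [p∸n]·1≡-n·1 n n≤p = +-inverseʳ-unique (n ·1) _
    (trans (sym (·1-homo-+ n (p ∸ n))) (trans (cong _·1 (ℕ.m+[n∸m]≡n n≤p)) char-p))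

  ·1-invertible : ∀ n → 0 < n → n < p → ∃ λ u → (u ℕ.* n) ·1 ≡ 1#
  ·1-invertible n 0<n n<p with coprime-Bézout (prime⇒coprime p-prime {{ℕ.>-nonZero 0<n}} n<p)
  ... | Bézout.-+ x y 1+xp≡yn = y , (begin
    (y ℕ.* n) ·1          ≡⟨ cong _·1 1+xp≡yn ⟨
    (1 ℕ.+ x ℕ.* p) ·1    ≡⟨ ·1-homo-+ 1 (x ℕ.* p) ⟩
    1 ·1 + (x ℕ.* p) ·1   ≡⟨ cong₂ _+_ 1·1≡1# (multiple·1≡0 x) ⟩
    1# + 0#               ≡⟨ +-identityʳ 1# ⟩
    1#                    ∎)
    where open ≡-Reasoning
  ... | Bézout.+- x y 1+yn≡xp = (p ∸ 1) ℕ.* y , (begin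
    ((p ∸ 1) ℕ.* y ℕ.* n) ·1      ≡⟨ cong _·1 (ℕ.*-assoc (p ∸ 1) y n) ⟩
    ((p ∸ 1) ℕ.* (y ℕ.* n)) ·1    ≡⟨ ·1-homo-* (p ∸ 1) (y ℕ.* n) ⟩
    (p ∸ 1) ·1 * (y ℕ.* n) ·1     ≡⟨ cong₂ _*_ ([p∸n]·1≡-n·1 1 (ℕ.<⇒≤ 1<p)) yn·1≡-1 ⟩
    - (1 ·1) * - (1 ·1)           ≡⟨ solve 0 (:- con (ℤ.+ 1) :* :- con (ℤ.+ 1) := con (ℤ.+ 1)) refl ⟩
    1 ·1                          ≡⟨ 1·1≡1# ⟩
    1#                            ∎)
    where
    open ≡-Reasoning
    yn·1≡-1 : (y ℕ.* n) ·1 ≡ - (1 ·1)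
    yn·1≡-1 = +-inverseʳ-unique (1 ·1) _
      (trans (sym (·1-homo-+ 1 (y ℕ.* n))) (trans (cong _·1 1+yn≡xp) (multiple·1≡0 x)))

  ·1≢0 : ∀ n → 0 < n → n < p → n ·1 ≢ 0#
  ·1≢0 n 0<n n<p n·1≡0 with ·1-invertible n 0<n n<p
  ... | u , un·1≡1 = 0≢1 (begin
    0#             ≡⟨ zeroʳ (u ·1) ⟨
    u ·1 * 0#      ≡⟨ cong (u ·1 *_) n·1≡0 ⟨
    u ·1 * n ·1    ≡⟨ ·1-homo-* u n ⟨
    (u ℕ.* n) ·1   ≡⟨ un·1≡1 ⟩
    1#             ∎)
    where open ≡-Reasoning

  ·1-distinct : ∀ {a b} → a < b → b < p → a ·1 ≢ b ·1
  ·1-distinct {a} {b} a<b b<p a·1≡b·1 = ·1≢0 (b ∸ a) (ℕ.m<n⇒0<n∸m a<b) (ℕ.≤-<-trans (ℕ.m∸n≤m b a) b<p)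
    (+-cancelˡ (a ·1) _ _ (begin
      a ·1 + (b ∸ a) ·1    ≡⟨ ·1-homo-+ a (b ∸ a) ⟨
      (a ℕ.+ (b ∸ a)) ·1   ≡⟨ cong _·1 (ℕ.m+[n∸m]≡n (ℕ.<⇒≤ a<b)) ⟩
      b ·1                 ≡⟨ a·1≡b·1 ⟨
      a ·1                 ≡⟨ +-identityʳ (a ·1) ⟨
      a ·1 + 0#            ∎))
    where open ≡-Reasoning

  ·1-injective : ∀ a b → a < p → b < p → a ·1 ≡ b ·1 → a ≡ b
  ·1-injective a b a<p b<p a·1≡b·1 with ℕ.<-cmp a b
  ... | tri< a<b _ _ = ⊥-elim (·1-distinct a<b b<p a·1≡b·1)
  ... | tri≈ _ a≡b _ = a≡b
  ... | tri> _ _ b<a = ⊥-elim (·1-distinct b<a a<p (sym a·1≡b·1))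

  frobenius : ∀ x y → pow (x + y) p ≡ pow x p + pow y p
  frobenius x y = subst (λ n → pow (x + y) n ≡ pow x n + pow y n) (ℕ.suc-pred p)
    (inner-binomials≡0⇒pow-homo-+ (ℕ.pred p) C≡0 x y)
    where
    C≡0 : ∀ k → 0 < k → k < suc (ℕ.pred p) → (suc (ℕ.pred p) C k) ·1 ≡ 0#
    C≡0 k 0<k k<p with prime∣choose p-prime 0<k (subst (k <_) (ℕ.suc-pred p) k<p)
    ... | divides d pCk≡dp =
      trans (cong (λ n → (n C k) ·1) (ℕ.suc-pred p)) (trans (cong _·1 pCk≡dp) (multiple·1≡0 d))

module Fermat (𝔽 : FiniteField) where
  open FieldRing 𝔽
  open Sums *-commutativeMonoid using (module Enumerated)
  open Enumerated enum renaming (∑ to ∏; ∑≡sum to ∏≡product; ∑-cong to ∏-cong; ∑-distrib to ∏-distrib;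
                                 ∑-δ to ∏-δ; ∑-reindex to ∏-reindex)
  open import Algebra.Properties.CommutativeMonoid.Sum *-commutativeMonoid using () renaming (sum to product)

  product-≢0 : ∀ n (f : Fin n → F) → (∀ i → f i ≢ 0#) → product f ≢ 0#
  product-≢0 zero    f f≢0 1≡0 = 0≢1 (sym 1≡0)
  product-≢0 (suc n) f f≢0 f0·rest≡0 =
    product-≢0 n (f ∘ suc) (f≢0 ∘ suc) (*-cancelˡ-0 (f zero) _ (f≢0 zero) f0·rest≡0)

  product-const : ∀ n y → product {n} (λ _ → y) ≡ pow y n
  product-const zero    y = refl
  product-const (suc n) y = cong (y *_) (product-const n y)

  0↦1 : F → F
  0↦1 x with x ≟ 0#
  ... | yes _ = 1#
  ... | no  _ = x

  0↦1-≢0 : ∀ x → 0↦1 x ≢ 0#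
  0↦1-≢0 x with x ≟ 0#
  ... | yes _   = λ 1≡0 → 0≢1 (sym 1≡0)
  ... | no  x≢0 = x≢0

  ∏0↦1 : F
  ∏0↦1 = ∏ 0↦1

  ∏0↦1≢0 : ∏0↦1 ≢ 0#
  ∏0↦1≢0 ∏0↦1≡0 = product-≢0 size _ (0↦1-≢0 ∘ Inverse.to enum) (trans (sym (∏≡product 0↦1)) ∏0↦1≡0)

  module _ {y : F} (y≢0 : y ≢ 0#) where
    0↦y : F → F
    0↦y x with x ≟ 0#
    ... | yes _ = y
    ... | no  _ = 1#

    y·0↦1 : ∀ x → y * 0↦1 x ≡ 0↦1 (y * x) * 0↦y x
    y·0↦1 x with x ≟ 0#
    y·0↦1 x | yes refl with (y * 0#) ≟ 0#
    ... | yes _    = trans (*-identityʳ y) (sym (*-identityˡ y))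
    ... | no y0≢0  = ⊥-elim (y0≢0 (zeroʳ y))
    y·0↦1 x | no x≢0 with (y * x) ≟ 0#
    ... | yes yx≡0 = ⊥-elim (x≢0 (*-cancelˡ-0 y x y≢0 yx≡0))
    ... | no _     = sym (*-identityʳ _)

    ∏0↦y≡y : ∏ 0↦y ≡ y
    ∏0↦y≡y = trans (∏-δ 0↦y 0# 0↦y[x≢0]) 0↦y[0]
      where
      0↦y[x≢0] : ∀ x → x ≢ 0# → 0↦y x ≡ 1#
      0↦y[x≢0] x x≢0 with x ≟ 0#
      ... | yes x≡0 = ⊥-elim (x≢0 x≡0)
      ... | no  _   = refl
      0↦y[0] : 0↦y 0# ≡ y
      0↦y[0] with 0# ≟ 0#
      ... | yes _   = refl
      ... | no 0≢0  = ⊥-elim (0≢0 refl)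

    -- Multiplying every factor of ∏0↦1 by y permutes the nonzero factors and turns the factor 1 into y.
    yᵠ∏0↦1≡∏0↦1y : pow y size * ∏0↦1 ≡ ∏0↦1 * y
    yᵠ∏0↦1≡∏0↦1y = begin
      pow y size * ∏0↦1
        ≡⟨ cong (_* ∏0↦1) (trans (sym (product-const size y)) (sym (∏≡product (λ _ → y)))) ⟩
      ∏ (λ _ → y) * ∏ 0↦1
        ≡⟨ ∏-distrib (λ _ → y) 0↦1 ⟨
      ∏ (λ x → y * 0↦1 x)
        ≡⟨ ∏-cong y·0↦1 ⟩
      ∏ (λ x → 0↦1 (y * x) * 0↦y x)
        ≡⟨ ∏-distrib (0↦1 ∘ (y *_)) 0↦y ⟩
      ∏ (0↦1 ∘ (y *_)) * ∏ 0↦y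
        ≡⟨ cong₂ _*_ (∏-reindex 0↦1 (*ˡ-↔ y≢0)) ∏0↦y≡y ⟩
      ∏0↦1 * y ∎
      where open ≡-Reasoning

  fermat : ∀ y → pow y size ≡ y
  fermat y with y ≟ 0#
  ... | yes refl = pow-0 size {{size≢0}}
    where
    size≢0 : NonZero size
    size≢0 with Inverse.from enum 0#
    ... | zero  = _
    ... | suc _ = _
  ... | no y≢0 = x-y≡0⇒x≡y _ _ (*-cancelˡ-0 ∏0↦1 _ ∏0↦1≢0 (begin
    ∏0↦1 * (pow y size + - y)
      ≡⟨ solve 3 (λ P a y → P :* (a :+ :- y) := a :* P :+ :- (P :* y)) refl ∏0↦1 (pow y size) y ⟩
    pow y size * ∏0↦1 + - (∏0↦1 * y)
      ≡⟨ cong (λ t → t + - (∏0↦1 * y)) (yᵠ∏0↦1≡∏0↦1y y≢0) ⟩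
    ∏0↦1 * y + - (∏0↦1 * y)
      ≡⟨ -‿inverseʳ _ ⟩
    0# ∎))
    where open ≡-Reasoning

module Polynomials (𝔽 : FiniteField) where
  open FieldRing 𝔽

  Poly : Set
  Poly = List F

  eval : Poly → F → F
  eval []       z = 0#
  eval (c ∷ f) z = c + z * eval f z

  lead : Poly → F
  lead []           = 0#
  lead (c ∷ [])     = c
  lead (c ∷ d ∷ f) = lead (d ∷ f)

  -- quotient r f is the quotient of c ∷ f by x - r, whatever the constant term c.
  quotient : F → Poly → Poly
  quotient r []       = []
  quotient r (d ∷ g) = eval (d ∷ g) r ∷ quotient r g

  eval-quotient : ∀ c f z r → eval (c ∷ f) z ≡ (z + - r) * eval (quotient r f) z + eval (c ∷ f) r
  eval-quotient c [] z r =
    solve 3 (λ c z r → c :+ z :* con (ℤ.+ 0) := (z :+ :- r) :* con (ℤ.+ 0) :+ (c :+ r :* con (ℤ.+ 0))) refl c z r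
  eval-quotient c (d ∷ g) z r = begin
    c + z * (d + z * eval g z)     ≡⟨ cong (λ t → c + z * t) (eval-quotient d g z r) ⟩
    c + z * ((z + - r) * q + e)    ≡⟨ solve 5 (λ c z r q e → c :+ z :* ((z :+ :- r) :* q :+ e) :=
                                                              (z :+ :- r) :* (e :+ z :* q) :+ (c :+ r :* e)) refl c z r q e ⟩
    (z + - r) * (e + z * q) + (c + r * e) ∎
    where
    open ≡-Reasoning
    q e : F
    q = eval (quotient r g) z
    e = d + r * eval g r

  length-quotient : ∀ r f → length (quotient r f) ≡ length f
  length-quotient r []       = refl
  length-quotient r (d ∷ f) = cong suc (length-quotient r f)

  lead-quotient : ∀ r d f → lead (quotient r (d ∷ f)) ≡ lead (d ∷ f)
  lead-quotient r d []       = trans (cong (d +_) (zeroʳ r)) (+-identityʳ d)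
  lead-quotient r d (e ∷ f) = lead-quotient r e f

  roots-of-quotient : ∀ c f r rs → All (r ≢_) rs → eval (c ∷ f) r ≡ 0# →
                      All (λ z → eval (c ∷ f) z ≡ 0#) rs → All (λ z → eval (quotient r f) z ≡ 0#) rs
  roots-of-quotient c f r []       []             _      []                = []
  roots-of-quotient c f r (z ∷ rs) (r≢z ∷ r≢rs) root-r (root-z ∷ root-rs) =
    *-cancelˡ-0 (z + - r) _ (λ z-r≡0 → r≢z (sym (x-y≡0⇒x≡y z r z-r≡0))) (begin
      (z + - r) * eval (quotient r f) z         ≡⟨ +-identityʳ _ ⟨
      (z + - r) * eval (quotient r f) z + 0#    ≡⟨ cong ((z + - r) * eval (quotient r f) z +_) root-r ⟨
      (z + - r) * eval (quotient r f) z + eval (c ∷ f) r  ≡⟨ eval-quotient c f z r ⟨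
      eval (c ∷ f) z                            ≡⟨ root-z ⟩
      0#                                        ∎)
    ∷ roots-of-quotient c f r rs r≢rs root-r root-rs
    where open ≡-Reasoning

  lead≡0-if-many-roots : ∀ rs f → Unique rs → 1 ≤ length f → length f ≤ length rs →
                         All (λ r → eval f r ≡ 0#) rs → lead f ≡ 0#
  lead≡0-if-many-roots (r ∷ rs) (c ∷ [])     _ _ _ (root-r ∷ _) =
    trans (sym (trans (cong (c +_) (zeroʳ r)) (+-identityʳ c))) root-r
  lead≡0-if-many-roots (r ∷ rs) (c ∷ d ∷ f) (r∉rs ∷ unique-rs) _ (s≤s |f|≤|rs|) (root-r ∷ root-rs) =
    trans (sym (lead-quotient r d f))
      (lead≡0-if-many-roots rs (quotient r (d ∷ f)) unique-rs (s≤s z≤n)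
        (subst (_≤ length rs) (sym (length-quotient r (d ∷ f))) |f|≤|rs|)
        (roots-of-quotient c (d ∷ f) r rs r∉rs root-r root-rs))

  monomial : F → ℕ → Poly
  monomial c zero    = c ∷ []
  monomial c (suc n) = 0# ∷ monomial c n

  eval-monomial : ∀ c n z → eval (monomial c n) z ≡ c * pow z n
  eval-monomial c zero    z = trans (cong (c +_) (zeroʳ z)) (trans (+-identityʳ c) (sym (*-identityʳ c)))
  eval-monomial c (suc n) z = trans (cong (λ t → 0# + z * t) (eval-monomial c n z))
    (solve 3 (λ c z w → con (ℤ.+ 0) :+ z :* (c :* w) := c :* (z :* w)) refl c z (pow z n))

  length-monomial : ∀ c n → length (monomial c n) ≡ suc n
  length-monomial c zero    = refl
  length-monomial c (suc n) = cong suc (length-monomial c n)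

  lead-monomial : ∀ c n → lead (monomial c n) ≡ c
  lead-monomial c zero          = refl
  lead-monomial c (suc zero)    = refl
  lead-monomial c (suc (suc n)) = lead-monomial c (suc n)

  infixl 6 _+ₚ_
  _+ₚ_ : Poly → Poly → Poly
  []      +ₚ g       = g
  (a ∷ f) +ₚ []      = a ∷ f
  (a ∷ f) +ₚ (b ∷ g) = (a + b) ∷ (f +ₚ g)

  eval-+ₚ : ∀ f g z → eval (f +ₚ g) z ≡ eval f z + eval g z
  eval-+ₚ []      g       z = sym (+-identityˡ _)
  eval-+ₚ (a ∷ f) []      z = sym (+-identityʳ _)
  eval-+ₚ (a ∷ f) (b ∷ g) z = trans (cong (λ t → (a + b) + z * t) (eval-+ₚ f g z))
    (solve 5 (λ a b z F G → (a :+ b) :+ z :* (F :+ G) := (a :+ z :* F) :+ (b :+ z :* G)) refl a b z (eval f z) (eval g z))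

  length-+ₚ : ∀ f g → length f < length g → length (f +ₚ g) ≡ length g
  length-+ₚ []      g       _          = refl
  length-+ₚ (a ∷ f) (b ∷ g) (s≤s |f|<|g|) = cong suc (length-+ₚ f g |f|<|g|)

  lead-+ₚ : ∀ f g → length f < length g → lead (f +ₚ g) ≡ lead g
  lead-+ₚ []           g           _            = refl
  lead-+ₚ (a ∷ [])     (b ∷ c ∷ g) _            = refl
  lead-+ₚ (a ∷ a' ∷ f) (b ∷ c ∷ g) (s≤s |f|<|g|) = lead-+ₚ (a' ∷ f) (c ∷ g) |f|<|g|
  lead-+ₚ (a ∷ [])     (b ∷ [])     (s≤s ())
  lead-+ₚ (a ∷ _ ∷ _)  (b ∷ [])     (s≤s ())

module Trace (𝔽 : FiniteField) (p m : ℕ) {{_ : NonZero p}} (p-prime : Prime p)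
             (char-p : FF._·1 𝔽 p ≡ FiniteField.0# 𝔽) (size≡pᵐ : FiniteField.size 𝔽 ≡ p ^ m) where
  open FieldRing 𝔽
  open PrimeCharacteristic 𝔽 p p-prime char-p
  open Fermat 𝔽 using (fermat)
  open Polynomials 𝔽

  tr : F → F
  tr = trace p m

  sumℕ-cong : ∀ n {f g : ℕ → F} → (∀ i → f i ≡ g i) → sumℕ n f ≡ sumℕ n g
  sumℕ-cong zero    f≡g = refl
  sumℕ-cong (suc n) f≡g = cong₂ _+_ (sumℕ-cong n f≡g) (f≡g n)

  sumℕ-distrib : ∀ n f g → sumℕ n (λ i → f i + g i) ≡ sumℕ n f + sumℕ n g
  sumℕ-distrib zero    f g = sym (+-identityˡ 0#)
  sumℕ-distrib (suc n) f g = trans (cong (_+ (f n + g n)) (sumℕ-distrib n f g))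
    (solve 4 (λ a b c d → (a :+ b) :+ (c :+ d) := (a :+ c) :+ (b :+ d)) refl (sumℕ n f) (sumℕ n g) (f n) (g n))

  sumℕ-shift : ∀ n f → sumℕ n (f ∘ suc) + f 0 ≡ sumℕ n f + f n
  sumℕ-shift zero    f = refl
  sumℕ-shift (suc n) f = begin
    (sumℕ n (f ∘ suc) + f (suc n)) + f 0  ≡⟨ solve 3 (λ a b c → (a :+ b) :+ c := (a :+ c) :+ b) refl _ _ _ ⟩
    (sumℕ n (f ∘ suc) + f 0) + f (suc n)  ≡⟨ cong (_+ f (suc n)) (sumℕ-shift n f) ⟩
    (sumℕ n f + f n) + f (suc n)          ∎
    where open ≡-Reasoning

  pow-pⁱ-homo-+ : ∀ i x y → pow (x + y) (p ^ i) ≡ pow x (p ^ i) + pow y (p ^ i)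
  pow-pⁱ-homo-+ zero    x y = trans (*-identityʳ _) (sym (cong₂ _+_ (*-identityʳ x) (*-identityʳ y)))
  pow-pⁱ-homo-+ (suc i) x y = begin
    pow (x + y) (p ℕ.* p ^ i)                      ≡⟨ pow-* (x + y) p (p ^ i) ⟩
    pow (pow (x + y) (p ^ i)) p                    ≡⟨ cong (λ t → pow t p) (pow-pⁱ-homo-+ i x y) ⟩
    pow (pow x (p ^ i) + pow y (p ^ i)) p          ≡⟨ frobenius _ _ ⟩
    pow (pow x (p ^ i)) p + pow (pow y (p ^ i)) p  ≡⟨ cong₂ _+_ (pow-* x p (p ^ i)) (pow-* y p (p ^ i)) ⟨
    pow x (p ℕ.* p ^ i) + pow y (p ℕ.* p ^ i)      ∎
    where open ≡-Reasoning

  pow-p-sumℕ : ∀ n f → pow (sumℕ n f) p ≡ sumℕ n (λ i → pow (f i) p)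
  pow-p-sumℕ zero    f = pow-0 p
  pow-p-sumℕ (suc n) f = trans (frobenius _ _) (cong (_+ pow (f n) p) (pow-p-sumℕ n f))

  tr-homo-+ : ∀ x y → tr (x + y) ≡ tr x + tr y
  tr-homo-+ x y = trans (sumℕ-cong m (λ i → pow-pⁱ-homo-+ i x y)) (sumℕ-distrib m _ _)

  tr-0 : tr 0# ≡ 0#
  tr-0 = +-cancelˡ (tr 0#) _ _
    (trans (sym (tr-homo-+ 0# 0#)) (trans (cong tr (+-identityʳ 0#)) (sym (+-identityʳ (tr 0#)))))

  tr-homo-- : ∀ x → tr (- x) ≡ - tr x
  tr-homo-- x = +-inverseʳ-unique (tr x) (tr (- x))
    (trans (sym (tr-homo-+ x (- x))) (trans (cong tr (-‿inverseʳ x)) tr-0))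

  -- The Frobenius map cyclically permutes the summands y^(p^i) of the trace, as y^(p^m) = y.
  tr-fixed-by-frobenius : ∀ y → pow (tr y) p ≡ tr y
  tr-fixed-by-frobenius y = begin
    pow (tr y) p                          ≡⟨ pow-p-sumℕ m _ ⟩
    sumℕ m (λ i → pow (pow y (p ^ i)) p)  ≡⟨ sumℕ-cong m (λ i → sym (pow-* y p (p ^ i))) ⟩
    sumℕ m (yᵖⁱ ∘ suc)                    ≡⟨ +-cancelʳ _ _ _ (trans (sumℕ-shift m yᵖⁱ) (cong (tr y +_) yᵖᵐ≡y¹)) ⟩
    tr y                                  ∎
    where
    open ≡-Reasoning
    yᵖⁱ : ℕ → F
    yᵖⁱ i = pow y (p ^ i)
    yᵖᵐ≡y¹ : yᵖⁱ m ≡ yᵖⁱ 0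
    yᵖᵐ≡y¹ = trans (subst (λ n → pow y n ≡ y) size≡pᵐ (fermat y)) (sym (*-identityʳ y))

  ·1-fixed-by-frobenius : ∀ n → pow (n ·1) p ≡ n ·1
  ·1-fixed-by-frobenius zero    = pow-0 p
  ·1-fixed-by-frobenius (suc n) = begin
    pow (1# + n ·1) p         ≡⟨ frobenius _ _ ⟩
    pow 1# p + pow (n ·1) p   ≡⟨ cong₂ _+_ (pow-1 p) (·1-fixed-by-frobenius n) ⟩
    1# + n ·1                 ∎
    where open ≡-Reasoning

  xᵖ-x : Poly
  xᵖ-x = monomial (- 1#) 1 +ₚ monomial 1# p

  length[x]<length[xᵖ] : length (monomial (- 1#) 1) < length (monomial 1# p)
  length[x]<length[xᵖ] = subst₂ _<_ (sym (length-monomial (- 1#) 1)) (sym (length-monomial 1# p)) (s≤s 1<p)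

  lead-xᵖ-x : lead xᵖ-x ≡ 1#
  lead-xᵖ-x = trans (lead-+ₚ (monomial (- 1#) 1) (monomial 1# p) length[x]<length[xᵖ]) (lead-monomial 1# p)

  length-xᵖ-x : length xᵖ-x ≡ suc p
  length-xᵖ-x = trans (length-+ₚ (monomial (- 1#) 1) (monomial 1# p) length[x]<length[xᵖ]) (length-monomial 1# p)

  frobenius-fixed⇒root : ∀ r → pow r p ≡ r → eval xᵖ-x r ≡ 0#
  frobenius-fixed⇒root r rᵖ≡r = begin
    eval xᵖ-x r
      ≡⟨ eval-+ₚ (monomial (- 1#) 1) (monomial 1# p) r ⟩
    eval (monomial (- 1#) 1) r + eval (monomial 1# p) r
      ≡⟨ cong₂ _+_ (eval-monomial (- 1#) 1 r) (eval-monomial 1# p r) ⟩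
    - 1# * (r * 1#) + 1# * pow r p
      ≡⟨ cong (λ t → - 1# * (r * 1#) + 1# * t) rᵖ≡r ⟩
    - 1# * (r * 1#) + 1# * r
      ≡⟨ cong₂ (λ a b → - 1# * a + b) (*-identityʳ r) (*-identityˡ r) ⟩
    - 1# * r + r
      ≡⟨ cong (_+ r) (-1*x≈-x r) ⟩
    - r + r
      ≡⟨ -‿inverseˡ r ⟩
    0# ∎
    where open ≡-Reasoning

  InPrimeField : F → Set
  InPrimeField c = ∃ λ (s : Fin p) → toℕ s ·1 ≡ c

  -- Otherwise x^p - x would have the p + 1 distinct roots z and s·1 (s < p).
  frobenius-fixed⇒InPrimeField : ∀ z → pow z p ≡ z → InPrimeField z
  frobenius-fixed⇒InPrimeField z zᵖ≡z with Fin.any? (λ (s : Fin p) → (toℕ s ·1) ≟ z)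
  ... | yes z∈𝔽ₚ = z∈𝔽ₚ
  ... | no  z∉𝔽ₚ = ⊥-elim (0≢1 (sym (trans (sym lead-xᵖ-x)
          (lead≡0-if-many-roots roots xᵖ-x unique-roots (subst (1 ≤_) (sym length-xᵖ-x) (s≤s z≤n))
             (ℕ.≤-reflexive (trans length-xᵖ-x (sym length-roots))) all-roots))))
    where
    ι : Fin p → F
    ι s = toℕ s ·1
    roots : List F
    roots = z ∷ map ι (allFin p)
    length-roots : length roots ≡ suc p
    length-roots = cong suc (trans (List.length-map ι (allFin p)) (List.length-tabulate id))
    unique-roots : Unique roots
    unique-roots = All.map⁺ (All.universal (λ s z≡s → z∉𝔽ₚ (s , sym z≡s)) (allFin p))
                 ∷ Unique.map⁺ (λ {a} {b} → Fin.toℕ-injective ∘ ·1-injective _ _ (Fin.toℕ<n a) (Fin.toℕ<n b))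
                               (Unique.allFin⁺ p)
    all-roots : All (λ r → eval xᵖ-x r ≡ 0#) roots
    all-roots = frobenius-fixed⇒root z zᵖ≡z
              ∷ All.map⁺ (All.universal (λ s → frobenius-fixed⇒root (ι s) (·1-fixed-by-frobenius (toℕ s))) (allFin p))

  tr∈𝔽ₚ : ∀ y → InPrimeField (tr y)
  tr∈𝔽ₚ y = frobenius-fixed⇒InPrimeField (tr y) (tr-fixed-by-frobenius y)

  tracePoly : ℕ → Poly
  tracePoly zero    = []
  tracePoly (suc i) = tracePoly i +ₚ monomial 1# (p ^ i)

  eval-tracePoly : ∀ i z → eval (tracePoly i) z ≡ sumℕ i (λ j → pow z (p ^ j))
  eval-tracePoly zero    z = refl
  eval-tracePoly (suc i) z = trans (eval-+ₚ (tracePoly i) _ z)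
    (cong₂ _+_ (eval-tracePoly i z) (trans (eval-monomial 1# (p ^ i) z) (*-identityˡ _)))

  pʲ<pʲ⁺¹ : ∀ j → p ^ j < p ^ suc j
  pʲ<pʲ⁺¹ j = subst (p ^ j <_) (ℕ.*-comm (p ^ j) p) (ℕ.m<m*n (p ^ j) p {{ℕ.m^n≢0 p j}} 1<p)

  length[tracePoly]<length[monomial] : ∀ i → length (tracePoly i) < length (monomial 1# (p ^ i))
  length-tracePoly : ∀ j → length (tracePoly (suc j)) ≡ suc (p ^ j)

  length[tracePoly]<length[monomial] zero    = s≤s z≤n
  length[tracePoly]<length[monomial] (suc j) =
    subst₂ _<_ (sym (length-tracePoly j)) (sym (length-monomial 1# (p ^ suc j))) (s≤s (pʲ<pʲ⁺¹ j))

  length-tracePoly j = trans (length-+ₚ (tracePoly j) (monomial 1# (p ^ j)) (length[tracePoly]<length[monomial] j))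
                             (length-monomial 1# (p ^ j))

  lead-tracePoly : ∀ j → lead (tracePoly (suc j)) ≡ 1#
  lead-tracePoly j = trans (lead-+ₚ (tracePoly j) (monomial 1# (p ^ j)) (length[tracePoly]<length[monomial] j))
                           (lead-monomial 1# (p ^ j))

  unique-elements : Unique elements
  unique-elements = Unique.map⁺ (λ {x} {y} x≡y → trans (sym (Inverse.strictlyInverseʳ enum x))
                                  (trans (cong (Inverse.from enum) x≡y) (Inverse.strictlyInverseʳ enum y)))
                                (Unique.allFin⁺ size)

  length-elements : length elements ≡ size
  length-elements = trans (List.length-map (Inverse.to enum) (allFin size)) (List.length-tabulate id)

  -- The trace over 𝔽_{p^k} is a polynomial of degree p^(k-1) < p^k with leading coefficient 1.
  trace-not-identically-0 : ∀ k → size ≡ p ^ k → ¬ All (λ y → trace p k y ≡ 0#) elements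
  trace-not-identically-0 zero    size≡1 _      = 0≢1 (begin
    0#                          ≡⟨ Inverse.strictlyInverseˡ enum 0# ⟨
    Inverse.to enum (from 0#)   ≡⟨ cong (Inverse.to enum) (Fin[1]-irrelevant size≡1 (from 0#) (from 1#)) ⟩
    Inverse.to enum (from 1#)   ≡⟨ Inverse.strictlyInverseˡ enum 1# ⟩
    1#                          ∎)
    where
    open ≡-Reasoning
    from : F → Fin size
    from = Inverse.from enum
    Fin[1]-irrelevant : ∀ {n} → n ≡ 1 → (a b : Fin n) → a ≡ b
    Fin[1]-irrelevant refl zero zero = refl
  trace-not-identically-0 (suc k) size≡pᵏ⁺¹ tr≡0 = 0≢1 (sym (trans (sym (lead-tracePoly k))
    (lead≡0-if-many-roots elements (tracePoly (suc k)) unique-elements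
      (subst (1 ≤_) (sym (length-tracePoly k)) (s≤s z≤n))
      (subst₂ _≤_ (sym (length-tracePoly k)) (sym (trans length-elements size≡pᵏ⁺¹)) (pʲ<pʲ⁺¹ k))
      (All.map (λ {y} trᵏ⁺¹y≡0 → trans (eval-tracePoly (suc k) y) trᵏ⁺¹y≡0) tr≡0))))

  tr-nontrivial : ∃ λ y → tr y ≢ 0#
  tr-nontrivial with Any.any? (λ y → ¬? (tr y ≟ 0#)) elements
  ... | yes trace-not-identically-0-somewhere = Any.satisfied trace-not-identically-0-somewhere
  ... | no  tr≡0-everywhere = ⊥-elim (trace-not-identically-0 m size≡pᵐ
          (All.map (decidable-stable (_ ≟ 0#)) (All.¬Any⇒All¬ elements tr≡0-everywhere)))

module CyclotomicArithmetic (p : ℕ) {{_ : NonZero p}} where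
  open Cyclotomic p

  infix 4 _≐_
  _≐_ : Cyc → Cyc → Set
  a ≐ b = ∀ k → a k ≡ b k

  infixr 2 _⟫_
  _⟫_ : ∀ {a b c} → a ≐ b → b ≐ c → a ≐ c
  (a≐b ⟫ b≐c) k = trans (a≐b k) (b≐c k)

  ≐-sym : ∀ {a b} → a ≐ b → b ≐ a
  ≐-sym a≐b k = sym (a≐b k)

  ⊕-commutativeMonoid : CommutativeMonoid _ _
  ⊕-commutativeMonoid = record
    { Carrier = Cyc ; _≈_ = _≐_ ; _∙_ = _⊕_ ; ε = 0c
    ; isCommutativeMonoid = record
      { isMonoid = record
        { isSemigroup = record
          { isMagma = record
            { isEquivalence = record { refl = λ k → refl ; sym = ≐-sym ; trans = _⟫_ }
            ; ∙-cong = λ a≐b c≐d k → cong₂ ℤ._+_ (a≐b k) (c≐d k) }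
          ; assoc = λ a b c k → ℤ.+-assoc (a k) (b k) (c k) }
        ; identity = (λ a k → ℤ.+-identityˡ (a k)) , (λ a k → ℤ.+-identityʳ (a k)) }
      ; comm = λ a b k → ℤ.+-comm (a k) (b k) } }

  open Sums ⊕-commutativeMonoid public using (sumₗ)
  module ℤSums = Sums ℤ.+-0-commutativeMonoid
  open import Algebra.Properties.CommutativeMonoid.Sum ℤ.+-0-commutativeMonoid using (∑-distrib-+)

  sumFin-cong : ∀ {f g} → (∀ i → f i ≡ g i) → sumFin p f ≡ sumFin p g
  sumFin-cong = ℤSums.sumₗ-cong (allFin p)

  sumFin-zero : ∀ f → (∀ i → f i ≡ ℤ.0ℤ) → sumFin p f ≡ ℤ.0ℤ
  sumFin-zero f f≡0 = trans (ℤSums.sumₗ-allFin p f) (ℤSums.sum-zero p f f≡0)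

  sumFin-δ : ∀ f (s : Fin p) → (∀ i → i ≢ s → f i ≡ ℤ.0ℤ) → sumFin p f ≡ f s
  sumFin-δ f s f≡0 = trans (ℤSums.sumₗ-allFin p f) (ℤSums.sum-δ p f s f≡0)

  sumFin-distrib : ∀ f g → sumFin p (λ i → f i ℤ.+ g i) ≡ sumFin p f ℤ.+ sumFin p g
  sumFin-distrib f g = trans (ℤSums.sumₗ-allFin p _)
    (trans (∑-distrib-+ f g) (sym (cong₂ ℤ._+_ (ℤSums.sumₗ-allFin p f) (ℤSums.sumₗ-allFin p g))))

  toℕ-idx : ∀ n → toℕ (idx n) ≡ n % p
  toℕ-idx n = Fin.toℕ-fromℕ< (m%n<n n p)

  idx[k+p]≡k : ∀ (k : Fin p) → idx (toℕ k ℕ.+ p) ≡ k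
  idx[k+p]≡k k = Fin.toℕ-injective (begin
    toℕ (idx (toℕ k ℕ.+ p))    ≡⟨ toℕ-idx _ ⟩
    (toℕ k ℕ.+ p) % p          ≡⟨ cong (λ n → (toℕ k ℕ.+ n) % p) (ℕ.*-identityˡ p) ⟨
    (toℕ k ℕ.+ 1 ℕ.* p) % p    ≡⟨ [m+kn]%n≡m%n (toℕ k) 1 p ⟩
    toℕ k % p                  ≡⟨ m<n⇒m%n≡m (Fin.toℕ<n k) ⟩
    toℕ k                      ∎)
    where open ≡-Reasoning

  0ᵢ : Fin p
  0ᵢ = idx 0

  toℕ-0ᵢ : toℕ 0ᵢ ≡ 0
  toℕ-0ᵢ = trans (toℕ-idx 0) (m<n⇒m%n≡m (ℕ.>-nonZero⁻¹ p))

  ι-at-0 : ∀ n k → toℕ k ≡ 0 → ι n k ≡ n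
  ι-at-0 n k k≡0 with toℕ k | k≡0
  ... | .0 | refl = refl

  ι-off-0 : ∀ n k → toℕ k ≢ 0 → ι n k ≡ ℤ.0ℤ
  ι-off-0 n k k≢0 with toℕ k
  ... | zero  = ⊥-elim (k≢0 refl)
  ... | suc _ = refl

  ⊛-cong : ∀ {a a' b b'} → a ≐ a' → b ≐ b' → (a ⊛ b) ≐ (a' ⊛ b')
  ⊛-cong a≐a' b≐b' k = sumFin-cong (λ i → cong₂ ℤ._*_ (a≐a' i) (b≐b' _))

  ⊛-congˡ : ∀ a {b b'} → b ≐ b' → (a ⊛ b) ≐ (a ⊛ b')
  ⊛-congˡ a = ⊛-cong {a} (λ k → refl)

  ⊛-congʳ : ∀ {a a'} b → a ≐ a' → (a ⊛ b) ≐ (a' ⊛ b)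
  ⊛-congʳ b a≐a' = ⊛-cong {b = b} a≐a' (λ k → refl)

  conj-cong : ∀ {a b} → a ≐ b → conj a ≐ conj b
  conj-cong a≐b k = a≐b _

  ⊛-zeroˡ : ∀ a → (0c ⊛ a) ≐ 0c
  ⊛-zeroˡ a k = sumFin-zero _ (λ i → refl)

  ⊛-zeroʳ : ∀ a → (a ⊛ 0c) ≐ 0c
  ⊛-zeroʳ a k = sumFin-zero _ (λ i → ℤ.*-zeroʳ (a i))

  ⊛-distribˡ : ∀ c a b → (c ⊛ (a ⊕ b)) ≐ ((c ⊛ a) ⊕ (c ⊛ b))
  ⊛-distribˡ c a b k = trans (sumFin-cong (λ i → ℤ.*-distribˡ-+ (c i) _ _)) (sumFin-distrib _ _)

  ⊛-distribʳ : ∀ c a b → ((a ⊕ b) ⊛ c) ≐ ((a ⊛ c) ⊕ (b ⊛ c))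
  ⊛-distribʳ c a b k = trans (sumFin-cong (λ i → ℤ.*-distribʳ-+ _ (a i) (b i))) (sumFin-distrib _ _)

  ι-⊛ : ∀ n a → (ι n ⊛ a) ≐ (λ k → n ℤ.* a k)
  ι-⊛ n a k = begin
    (ι n ⊛ a) k
      ≡⟨ sumFin-δ _ 0ᵢ (λ i i≢0 → cong (ℤ._* _) (ι-off-0 n i (i≢0 ∘ toℕ≡0⇒≡0ᵢ))) ⟩
    ι n 0ᵢ ℤ.* a (idx (toℕ k ℕ.+ (p ∸ toℕ 0ᵢ)))
      ≡⟨ cong₂ (λ x t → x ℤ.* a (idx (toℕ k ℕ.+ (p ∸ t)))) (ι-at-0 n 0ᵢ toℕ-0ᵢ) toℕ-0ᵢ ⟩
    n ℤ.* a (idx (toℕ k ℕ.+ p))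
      ≡⟨ cong (λ j → n ℤ.* a j) (idx[k+p]≡k k) ⟩
    n ℤ.* a k ∎
    where
    open ≡-Reasoning
    toℕ≡0⇒≡0ᵢ : ∀ {i} → toℕ i ≡ 0 → i ≡ 0ᵢ
    toℕ≡0⇒≡0ᵢ i≡0 = Fin.toℕ-injective (trans i≡0 (sym toℕ-0ᵢ))

  ι-0 : ι ℤ.0ℤ ≐ 0c
  ι-0 k with toℕ k
  ... | zero  = refl
  ... | suc _ = refl

  ι-homo-+ : ∀ m n k → ι m k ℤ.+ ι n k ≡ ι (m ℤ.+ n) k
  ι-homo-+ m n k with toℕ k
  ... | zero  = refl
  ... | suc _ = refl

  *-ι : ∀ m n k → m ℤ.* ι n k ≡ ι (m ℤ.* n) k
  *-ι m n k with toℕ k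
  ... | zero  = refl
  ... | suc _ = ℤ.*-zeroʳ m

  ι-⊛-ι : ∀ m n → (ι m ⊛ ι n) ≐ ι (m ℤ.* n)
  ι-⊛-ι m n = ι-⊛ m (ι n) ⟫ *-ι m n

  sumₗ-⊛ : ∀ {A : Set} (f : A → Cyc) c xs → (sumₗ f xs ⊛ c) ≐ sumₗ (λ x → f x ⊛ c) xs
  sumₗ-⊛ f c []       = ⊛-zeroˡ c
  sumₗ-⊛ f c (x ∷ xs) = ⊛-distribʳ c (f x) (sumₗ f xs) ⟫ (λ k → cong (ℤ._+_ ((f x ⊛ c) k)) (sumₗ-⊛ f c xs k))

  ⊛-sumₗ : ∀ {A : Set} (f : A → Cyc) c xs → (c ⊛ sumₗ f xs) ≐ sumₗ (λ x → c ⊛ f x) xs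
  ⊛-sumₗ f c []       = ⊛-zeroʳ c
  ⊛-sumₗ f c (x ∷ xs) = ⊛-distribˡ c (f x) (sumₗ f xs) ⟫ (λ k → cong (ℤ._+_ ((c ⊛ f x) k)) (⊛-sumₗ f c xs k))

  conj-sumₗ : ∀ {A : Set} (f : A → Cyc) xs → conj (sumₗ f xs) ≐ sumₗ (conj ∘ f) xs
  conj-sumₗ f []       k = refl
  conj-sumₗ f (x ∷ xs) k = cong (ℤ._+_ (conj (f x) k)) (conj-sumₗ f xs k)

  sumₗ-ι1 : ∀ {A : Set} (xs : List A) → sumₗ (λ _ → ι ℤ.1ℤ) xs ≐ ι (ℤ.+ length xs)
  sumₗ-ι1 []       k = sym (ι-0 k)
  sumₗ-ι1 (x ∷ xs) k = trans (cong (ℤ._+_ (ι ℤ.1ℤ k)) (sumₗ-ι1 xs k)) (ι-homo-+ ℤ.1ℤ _ k)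

  ≐⇒≈ : ∀ {a b} → a ≐ b → a ≈ b
  ≐⇒≈ {a} {b} a≐b = ℤ.0ℤ , λ k → trans (cong (ℤ._-_ (a k)) (sym (a≐b k))) (ℤ.+-inverseʳ (a k))

  ≈-trans : ∀ {a b c} → a ≈ b → b ≈ c → a ≈ c
  ≈-trans {a} {b} {c} (x , a-b≡x) (y , b-c≡y) =
    x ℤ.+ y , λ k → trans (a-c≡[a-b]+[b-c] (a k) (b k) (c k)) (cong₂ ℤ._+_ (a-b≡x k) (b-c≡y k))
    where
    a-c≡[a-b]+[b-c] : ∀ a b c → a ℤ.- c ≡ (a ℤ.- b) ℤ.+ (b ℤ.- c)
    a-c≡[a-b]+[b-c] = solve 3 (λ a b c → a :- c := (a :- b) :+ (b :- c)) refl
      where open ℤSolver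

  ≐-≈-trans : ∀ {a b c} → a ≐ b → b ≈ c → a ≈ c
  ≐-≈-trans {a} {b} {c} a≐b = ≈-trans {a} {b} {c} (≐⇒≈ a≐b)

  ≈-≐-trans : ∀ {a b c} → a ≈ b → b ≐ c → a ≈ c
  ≈-≐-trans {a} {b} {c} a≈b b≐c = ≈-trans {a} {b} {c} a≈b (≐⇒≈ b≐c)

  sumₗ-≈ : ∀ {A : Set} {f g : A → Cyc} xs → (∀ x → f x ≈ g x) → sumₗ f xs ≈ sumₗ g xs
  sumₗ-≈ []       f≈g = ℤ.0ℤ , λ k → refl
  sumₗ-≈ {f = f} {g} (x ∷ xs) f≈g with f≈g x | sumₗ-≈ xs f≈g
  ... | c , fx-gx≡c | d , Σf-Σg≡d =
    c ℤ.+ d , λ k → trans (interchange (f x k) (sumₗ f xs k) (g x k) (sumₗ g xs k))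
                          (cong₂ ℤ._+_ (fx-gx≡c k) (Σf-Σg≡d k))
    where
    interchange : ∀ a b c d → (a ℤ.+ b) ℤ.- (c ℤ.+ d) ≡ (a ℤ.- c) ℤ.+ (b ℤ.- d)
    interchange = solve 4 (λ a b c d → (a :+ b) :- (c :+ d) := (a :- c) :+ (b :- d)) refl
      where open ℤSolver

  ι-⊛-≈ : ∀ n {a b} → a ≈ b → (ι n ⊛ a) ≈ (ι n ⊛ b)
  ι-⊛-≈ n {a} {b} (c , a-b≡c) = n ℤ.* c , λ k →
    trans (cong₂ ℤ._-_ (ι-⊛ n a k) (ι-⊛ n b k)) (trans (na-nb≡n[a-b] n (a k) (b k)) (cong (n ℤ.*_) (a-b≡c k)))
    where
    na-nb≡n[a-b] : ∀ n a b → n ℤ.* a ℤ.- n ℤ.* b ≡ n ℤ.* (a ℤ.- b)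
    na-nb≡n[a-b] = solve 3 (λ n a b → n :* a :- n :* b := n :* (a :- b)) refl
      where open ℤSolver

  -- Constant coefficient vectors denote 0, since 1 + ω + … + ω^(p-1) = 0.
  constant≈0 : ∀ a → (∀ k → a k ≡ a 0ᵢ) → a ≈ 0c
  constant≈0 a a-const = a 0ᵢ , λ k → trans (ℤ.+-identityʳ (a k)) (a-const k)

module AdditiveCharacters (𝔽 : FiniteField) (p m : ℕ) {{_ : NonZero p}} (p-prime : Prime p)
                          (char-p : FF._·1 𝔽 p ≡ FiniteField.0# 𝔽) (size≡pᵐ : FiniteField.size 𝔽 ≡ p ^ m) where
  open FieldRing 𝔽
  open PrimeCharacteristic 𝔽 p p-prime char-p
  open Trace 𝔽 p m p-prime char-p size≡pᵐ
  open Vectors p m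
  open CyclotomicArithmetic p
  open Sums ⊕-commutativeMonoid using (module Enumerated)
  open Enumerated enum

  -- The coefficient at position k of an element of ℤ[ω_p] belongs to ω_p^(exponent k).
  exponent : Fin p → F
  exponent k = toℕ k ·1

  exponent-idx : ∀ n → exponent (idx n) ≡ n ·1
  exponent-idx n = trans (cong _·1 (toℕ-idx n)) (sym (·1≡%·1 n))

  exponent-injective : ∀ {a b} → exponent a ≡ exponent b → a ≡ b
  exponent-injective {a} {b} = Fin.toℕ-injective ∘ ·1-injective (toℕ a) (toℕ b) (Fin.toℕ<n a) (Fin.toℕ<n b)

  exponent-0ᵢ : exponent 0ᵢ ≡ 0#
  exponent-0ᵢ = cong _·1 toℕ-0ᵢ

  infixl 6 _-ᵢ_
  _-ᵢ_ : Fin p → Fin p → Fin p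
  k -ᵢ s = idx (toℕ k ℕ.+ (p ∸ toℕ s))

  exponent-ᵢ : ∀ k s → exponent (k -ᵢ s) ≡ exponent k + - exponent s
  exponent-ᵢ k s = begin
    exponent (k -ᵢ s)                  ≡⟨ exponent-idx (toℕ k ℕ.+ (p ∸ toℕ s)) ⟩
    (toℕ k ℕ.+ (p ∸ toℕ s)) ·1         ≡⟨ ·1-homo-+ (toℕ k) _ ⟩
    exponent k + (p ∸ toℕ s) ·1        ≡⟨ cong (exponent k +_) ([p∸n]·1≡-n·1 (toℕ s) (ℕ.<⇒≤ (Fin.toℕ<n s))) ⟩
    exponent k + - exponent s          ∎
    where open ≡-Reasoning

  exponent-conj : ∀ k → exponent (idx (p ∸ toℕ k)) ≡ - exponent k
  exponent-conj k = trans (exponent-idx (p ∸ toℕ k)) ([p∸n]·1≡-n·1 (toℕ k) (ℕ.<⇒≤ (Fin.toℕ<n k)))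

  -- ω_p^c, meaningful for c in the prime field 𝔽ₚ (the image of Fin p under exponent).
  χ : F → Cyc
  χ c k with exponent k ≟ c
  ... | yes _ = ℤ.1ℤ
  ... | no  _ = ℤ.0ℤ

  χ-at : ∀ c k → exponent k ≡ c → χ c k ≡ ℤ.1ℤ
  χ-at c k k≡c with exponent k ≟ c
  ... | yes _   = refl
  ... | no  k≢c = ⊥-elim (k≢c k≡c)

  χ-off : ∀ c k → exponent k ≢ c → χ c k ≡ ℤ.0ℤ
  χ-off c k k≢c with exponent k ≟ c
  ... | yes k≡c = ⊥-elim (k≢c k≡c)
  ... | no  _   = refl

  χ-resp : ∀ c d k l → (exponent k ≡ c → exponent l ≡ d) → (exponent l ≡ d → exponent k ≡ c) → χ c k ≡ χ d l
  χ-resp c d k l to from with exponent k ≟ c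
  ... | yes k≡c = sym (χ-at d l (to k≡c))
  ... | no  k≢c = sym (χ-off d l (k≢c ∘ from))

  χ-cong : ∀ {c d} → c ≡ d → χ c ≐ χ d
  χ-cong refl k = refl

  ωtr≐χ∘tr : ∀ y → ωtr y ≐ χ (tr y)
  ωtr≐χ∘tr y k with exponent k ≟ tr y
  ... | yes _ = refl
  ... | no  _ = refl

  χ-0 : χ 0# ≐ ι ℤ.1ℤ
  χ-0 k with toℕ k ℕ.≟ 0
  ... | yes k≡0 = trans (χ-at 0# k (cong _·1 k≡0)) (sym (ι-at-0 ℤ.1ℤ k k≡0))
  ... | no  k≢0 = trans (χ-off 0# k (·1≢0 (toℕ k) (ℕ.n≢0⇒n>0 k≢0) (Fin.toℕ<n k))) (sym (ι-off-0 ℤ.1ℤ k k≢0))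

  χ-⊛ : ∀ s x → (χ (exponent s) ⊛ x) ≐ (λ k → x (k -ᵢ s))
  χ-⊛ s x k = begin
    (χ (exponent s) ⊛ x) k
      ≡⟨ sumFin-δ _ s (λ i i≢s → cong (ℤ._* _) (χ-off _ i (i≢s ∘ exponent-injective))) ⟩
    χ (exponent s) s ℤ.* x (k -ᵢ s)
      ≡⟨ cong (ℤ._* x (k -ᵢ s)) (χ-at _ s refl) ⟩
    ℤ.1ℤ ℤ.* x (k -ᵢ s)
      ≡⟨ ℤ.*-identityˡ _ ⟩
    x (k -ᵢ s) ∎
    where open ≡-Reasoning

  χ-⊛-χ : ∀ {c} d → InPrimeField c → (χ c ⊛ χ d) ≐ χ (c + d)
  χ-⊛-χ {c} d (s , s≡c) = ⊛-congʳ (χ d) (χ-cong (sym s≡c)) ⟫ χ-⊛ s (χ d) ⟫ λ k →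
    χ-resp d (c + d) (k -ᵢ s) k
      (λ k-s≡d → trans (solve 2 (λ x c → x := c :+ (x :+ :- c)) refl (exponent k) c)
                       (cong (c +_) (trans (cong (λ t → exponent k + - t) (sym s≡c)) (trans (sym (exponent-ᵢ k s)) k-s≡d))))
      (λ k≡c+d → trans (exponent-ᵢ k s) (trans (cong₂ (λ a b → a + - b) k≡c+d s≡c)
                       (solve 2 (λ c d → (c :+ d) :+ :- c := d) refl c d)))

  conj-χ : ∀ c → conj (χ c) ≐ χ (- c)
  conj-χ c k = χ-resp c (- c) _ k
    (λ -k≡c → trans (sym (-‿involutive (exponent k))) (cong -_ (trans (sym (exponent-conj k)) -k≡c)))
    (λ k≡-c → trans (exponent-conj k) (trans (cong -_ k≡-c) (-‿involutive c)))

  ψ : F → Cyc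
  ψ = ωtr

  ψ-cong : ∀ {a b} → a ≡ b → ψ a ≐ ψ b
  ψ-cong refl k = refl

  ψ-0 : ψ 0# ≐ ι ℤ.1ℤ
  ψ-0 = ωtr≐χ∘tr 0# ⟫ χ-cong tr-0 ⟫ χ-0

  -tr∈𝔽ₚ : ∀ y → InPrimeField (- tr y)
  -tr∈𝔽ₚ y with tr∈𝔽ₚ (- y)
  ... | s , s≡tr[-y] = s , trans s≡tr[-y] (tr-homo-- y)

  conj-ψ-⊛-ψ : ∀ a b → (conj (ψ a) ⊛ ψ b) ≐ ψ (b + - a)
  conj-ψ-⊛-ψ a b = ⊛-cong (conj-cong (ωtr≐χ∘tr a) ⟫ conj-χ (tr a)) (ωtr≐χ∘tr b)
    ⟫ χ-⊛-χ (tr b) (-tr∈𝔽ₚ a)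
    ⟫ χ-cong (trans (+-comm _ _) (sym (trans (tr-homo-+ b (- a)) (cong (tr b +_) (tr-homo-- a)))))
    ⟫ ≐-sym (ωtr≐χ∘tr (b + - a))

  ψ-⊛-conj-ψ : ∀ a b → (ψ a ⊛ conj (ψ b)) ≐ ψ (a + - b)
  ψ-⊛-conj-ψ a b = ⊛-cong (ωtr≐χ∘tr a) (conj-cong (ωtr≐χ∘tr b) ⟫ conj-χ (tr b))
    ⟫ χ-⊛-χ (- tr b) (tr∈𝔽ₚ a)
    ⟫ χ-cong (sym (trans (tr-homo-+ a (- b)) (cong (tr a +_) (tr-homo-- b))))
    ⟫ ≐-sym (ωtr≐χ∘tr (a + - b))

  norm²-ψ : ∀ z → norm² (ψ z) ≐ ι ℤ.1ℤ
  norm²-ψ z = ψ-⊛-conj-ψ z z ⟫ ψ-cong (-‿inverseʳ z) ⟫ ψ-0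

  subtract-times : Fin p → ℕ → Fin p → Fin p
  subtract-times s zero    k = k
  subtract-times s (suc i) k = subtract-times s i k -ᵢ s

  exponent-subtract-times : ∀ k s i → exponent (subtract-times s i k) ≡ exponent k + - ((i ℕ.* toℕ s) ·1)
  exponent-subtract-times k s zero    = solve 1 (λ x → x := x :+ :- con (ℤ.+ 0)) refl (exponent k)
  exponent-subtract-times k s (suc i) = begin
    exponent (subtract-times s i k -ᵢ s)
      ≡⟨ exponent-ᵢ (subtract-times s i k) s ⟩
    exponent (subtract-times s i k) + - exponent s
      ≡⟨ cong (_+ - exponent s) (exponent-subtract-times k s i) ⟩
    (exponent k + - ((i ℕ.* toℕ s) ·1)) + - exponent s
      ≡⟨ solve 3 (λ a b c → (a :+ :- b) :+ :- c := a :+ :- (c :+ b)) refl _ _ _ ⟩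
    exponent k + - (exponent s + (i ℕ.* toℕ s) ·1)
      ≡⟨ cong (λ t → exponent k + - t) (·1-homo-+ (toℕ s) (i ℕ.* toℕ s)) ⟨
    exponent k + - ((suc i ℕ.* toℕ s) ·1) ∎
    where open ≡-Reasoning

  -- Shifting k by u·k·s, with u·s ≡ 1 mod p, reaches position 0.
  shift-invariant⇒constant : ∀ (a : Cyc) s → toℕ s ≢ 0 → (∀ k → a k ≡ a (k -ᵢ s)) → ∀ k → a k ≡ a 0ᵢ
  shift-invariant⇒constant a s s≢0 a-inv k with ·1-invertible (toℕ s) (ℕ.n≢0⇒n>0 s≢0) (Fin.toℕ<n s)
  ... | u , us≡1 = trans (a-invariant-times (u ℕ.* toℕ k)) (cong a (exponent-injective (begin
    exponent (subtract-times s (u ℕ.* toℕ k) k)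
      ≡⟨ exponent-subtract-times k s (u ℕ.* toℕ k) ⟩
    exponent k + - ((u ℕ.* toℕ k ℕ.* toℕ s) ·1)
      ≡⟨ cong (λ n → exponent k + - (n ·1)) (reorder u (toℕ k) (toℕ s)) ⟩
    exponent k + - ((toℕ k ℕ.* (u ℕ.* toℕ s)) ·1)
      ≡⟨ cong (λ t → exponent k + - t) (·1-homo-* (toℕ k) _) ⟩
    exponent k + - (exponent k * (u ℕ.* toℕ s) ·1)
      ≡⟨ cong (λ t → exponent k + - (exponent k * t)) us≡1 ⟩
    exponent k + - (exponent k * 1#)
      ≡⟨ cong (λ t → exponent k + - t) (*-identityʳ _) ⟩
    exponent k + - exponent k
      ≡⟨ -‿inverseʳ (exponent k) ⟩
    0#
      ≡⟨ exponent-0ᵢ ⟨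
    exponent 0ᵢ ∎)))
    where
    open ≡-Reasoning
    a-invariant-times : ∀ i → a k ≡ a (subtract-times s i k)
    a-invariant-times zero    = refl
    a-invariant-times (suc i) = trans (a-invariant-times i) (a-inv (subtract-times s i k))
    reorder : ∀ u k s → u ℕ.* k ℕ.* s ≡ k ℕ.* (u ℕ.* s)
    reorder = ℕSolver.solve 3 (λ u k s → u ℕSolver.:* k ℕSolver.:* s ℕSolver.:= k ℕSolver.:* (u ℕSolver.:* s)) refl

  ∑ψ-invariant : ∀ y → ∑ ψ ≐ (χ (tr y) ⊛ ∑ ψ)
  ∑ψ-invariant y = ≐-sym (∑-reindex ψ (+ˡ-↔ y))
    ⟫ ∑-cong (λ w → ωtr≐χ∘tr (y + w) ⟫ χ-cong (tr-homo-+ y w) ⟫ ≐-sym (χ-⊛-χ (tr w) (tr∈𝔽ₚ y))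
                    ⟫ ⊛-congˡ (χ (tr y)) (≐-sym (ωtr≐χ∘tr w)))
    ⟫ ≐-sym (⊛-sumₗ ψ (χ (tr y)) elements)

  ∑ψ≈0 : ∑ ψ ≈ 0c
  ∑ψ≈0 with tr-nontrivial
  ... | y , tr[y]≢0 with tr∈𝔽ₚ y
  ... | s , s≡tr[y] = constant≈0 (∑ ψ) (shift-invariant⇒constant (∑ ψ) s s≢0
          (∑ψ-invariant y ⟫ ⊛-congʳ (∑ ψ) (χ-cong (sym s≡tr[y])) ⟫ χ-⊛ s (∑ ψ)))
    where
    s≢0 : toℕ s ≢ 0
    s≢0 s≡0 = tr[y]≢0 (trans (sym s≡tr[y]) (cong _·1 s≡0))

  ∑ψ∘bijective≈0 : ∀ {g} → Bijective _≡_ _≡_ g → ∑ (ψ ∘ g) ≈ 0c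
  ∑ψ∘bijective≈0 {g} g-bijective =
    ≐-≈-trans {∑ (ψ ∘ g)} {∑ ψ} {0c} (∑-reindex ψ (⤖⇒↔ (mk⤖ g-bijective))) ∑ψ≈0

  δ₀ : Cyc → F → Cyc
  δ₀ c d with d ≟ 0#
  ... | yes _ = c
  ... | no  _ = 0c

  ∑-δ₀ : ∀ c → ∑ (δ₀ c) ≐ c
  ∑-δ₀ c = ∑-δ (δ₀ c) 0# δ₀-off ⟫ δ₀-at
    where
    δ₀-off : ∀ d → d ≢ 0# → δ₀ c d ≐ 0c
    δ₀-off d d≢0 with d ≟ 0#
    ... | yes d≡0 = ⊥-elim (d≢0 d≡0)
    ... | no  _   = λ k → refl
    δ₀-at : δ₀ c 0# ≐ c
    δ₀-at with 0# ≟ 0#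
    ... | yes _   = λ k → refl
    ... | no 0≢0  = ⊥-elim (0≢0 refl)

  ∑-const-ι1 : ∑ (λ _ → ι ℤ.1ℤ) ≐ ι (ℤ.+ size)
  ∑-const-ι1 = sumₗ-ι1 elements ⟫ λ k → cong (λ n → ι (ℤ.+ n) k) length-elements

  norm²-∑ψ∘G : ∀ G → norm² (∑ (ψ ∘ G)) ≐ ∑ (λ d → ∑ (ψ ∘ Δ G d))
  norm²-∑ψ∘G G =
      ⊛-congˡ (∑ (ψ ∘ G)) (conj-sumₗ (ψ ∘ G) elements)
    ⟫ sumₗ-⊛ (ψ ∘ G) (∑ (conj ∘ ψ ∘ G)) elements
    ⟫ ∑-cong (λ x → ⊛-sumₗ (conj ∘ ψ ∘ G) (ψ (G x)) elements ⟫ ∑-cong (λ y → ψ-⊛-conj-ψ (G x) (G y)))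
    ⟫ ∑-comm (λ x y → ψ (G x + - G y))
    ⟫ ∑-cong (λ y → ≐-sym (∑-reindex (λ x → ψ (G x + - G y)) (+ˡ-↔ y)))
    ⟫ ∑-comm (λ y d → ψ (G (y + d) + - G y))

  -- The term d = 0 of the double sum is q, and planarity kills every other term.
  planar⇒norm²∑ψ∘G≈q : ∀ G → Planar G → norm² (∑ (ψ ∘ G)) ≈ ι (ℤ.+ size)
  planar⇒norm²∑ψ∘G≈q G G-planar =
    ≐-≈-trans {norm² (∑ (ψ ∘ G))} {∑ (λ d → ∑ (ψ ∘ Δ G d))} {ι (ℤ.+ size)} (norm²-∑ψ∘G G)
      (≈-≐-trans {∑ (λ d → ∑ (ψ ∘ Δ G d))} {∑ (δ₀ (ι (ℤ.+ size)))} {ι (ℤ.+ size)}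
        (sumₗ-≈ elements inner-sum) (∑-δ₀ (ι (ℤ.+ size))))
    where
    inner-sum : ∀ d → ∑ (ψ ∘ Δ G d) ≈ δ₀ (ι (ℤ.+ size)) d
    inner-sum d with d ≟ 0#
    ... | yes refl = ≐⇒≈ (∑-cong (λ y → ψ-cong (trans (cong (λ t → G t + - G y) (+-identityʳ y)) (-‿inverseʳ (G y)))
                                      ⟫ ψ-0)
                          ⟫ ∑-const-ι1)
    ... | no d≢0 = ∑ψ∘bijective≈0 (G-planar d d≢0)

module MutuallyUnbiasedBases (𝔽 : FiniteField) (p m : ℕ) {{_ : NonZero p}} (p-prime : Prime p)
                             (char-p : FF._·1 𝔽 p ≡ FiniteField.0# 𝔽) (size≡pᵐ : FiniteField.size 𝔽 ≡ p ^ m) where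
  open FieldRing 𝔽
  open Vectors p m
  open CyclotomicArithmetic p
  open AdditiveCharacters 𝔽 p m p-prime char-p size≡pᵐ
  open Sums ⊕-commutativeMonoid using (module Enumerated)
  open Enumerated enum
  open ScaledFamily

  E-diag : ∀ y → vec E y y ≐ ι ℤ.1ℤ
  E-diag y k with y ≟ y
  ... | yes _   = refl
  ... | no y≢y  = ⊥-elim (y≢y refl)

  E-off : ∀ y x → x ≢ y → vec E y x ≐ 0c
  E-off y x x≢y k with x ≟ y
  ... | yes x≡y = ⊥-elim (x≢y x≡y)
  ... | no  _   = refl

  ι1-⊛ : ∀ a → (ι ℤ.1ℤ ⊛ a) ≐ a
  ι1-⊛ a k = trans (ι-⊛ ℤ.1ℤ a k) (ℤ.*-identityˡ (a k))

  conj-ι1 : conj (ι ℤ.1ℤ) ≐ ι ℤ.1ℤ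
  conj-ι1 = conj-cong (≐-sym χ-0) ⟫ conj-χ 0# ⟫ χ-cong -0#≈0# ⟫ χ-0

  ⟨E∣_⟩ : ∀ {y} u → ⟨ vec E y ∣ u ⟩ ≐ u y
  ⟨E∣_⟩ {y} u = ∑-δ _ y (λ x x≢y → ⊛-congʳ (u x) (conj-cong (E-off y x x≢y)) ⟫ ⊛-zeroˡ (u x))
              ⟫ ⊛-congʳ (u y) (conj-cong (E-diag y) ⟫ conj-ι1) ⟫ ι1-⊛ (u y)

  ⟨_∣E⟩ : ∀ u {y} → ⟨ u ∣ vec E y ⟩ ≐ (conj (u y) ⊛ ι ℤ.1ℤ)
  ⟨_∣E⟩ u {y} = ∑-δ _ y (λ x x≢y → ⊛-congˡ (conj (u x)) (E-off y x x≢y) ⟫ ⊛-zeroʳ (conj (u x)))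
              ⟫ ⊛-congˡ (conj (u y)) (E-diag y)

  norm²-cong : ∀ {a b} → a ≐ b → norm² a ≐ norm² b
  norm²-cong {a} {b} a≐b = ⊛-cong a≐b (conj-cong {a} {b} a≐b)

  qℤ1⊛ι : ∀ n → (qℤ 1 ⊛ ι (ℤ.+ n)) ≐ ι (ℤ.+ (q ℕ.* n))
  qℤ1⊛ι n = ι-⊛-ι (ℤ.+ (q ^ 1)) (ℤ.+ n) ⟫ λ k →
    cong (λ t → ι t k) (trans (sym (ℤ.pos-* (q ^ 1) n)) (cong (λ t → ℤ.+ (t ℕ.* n)) (ℕ.*-identityʳ q)))

  E-orthonormal : OrthonormalBasis E
  E-orthonormal = (λ y → ≐⇒≈ (⟨E∣ vec E y ⟩ ⟫ E-diag y))
                , (λ y y' y≢y' → ≐⇒≈ (⟨E∣ vec E y' ⟩ ⟫ E-off y' y y≢y'))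

  module _ (A : F → F) where
    phase : F → F → F → F
    phase a b x = A (x + a) + b * (x + a)

    ⟨V∣V⟩ : ∀ a b a' b' → ⟨ vec (V A a) b ∣ vec (V A a') b' ⟩ ≐ ∑ (λ x → ψ (phase a' b' x + - phase a b x))
    ⟨V∣V⟩ a b a' b' = ∑-cong (λ x → conj-ψ-⊛-ψ (phase a b x) (phase a' b' x))

    phase-b'-phase-b : ∀ a b b' x → phase a b' x + - phase a b x ≡ (b' + - b) * (x + a)
    phase-b'-phase-b a b b' x = solve 4 (λ α y b b' → (α :+ b' :* y) :+ :- (α :+ b :* y) := (b' :+ :- b) :* y)
                                   refl (A (x + a)) (x + a) b b'

    V-orthonormal : ∀ a → OrthonormalBasis (V A a)
    V-orthonormal a = diagonal , off-diagonal
      where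
      diagonal : ∀ b → ⟨ vec (V A a) b ∣ vec (V A a) b ⟩ ≈ qℤ 1
      diagonal b = ≐⇒≈ (⟨V∣V⟩ a b a b ⟫ ∑-cong (λ x → ψ-cong (-‿inverseʳ (phase a b x)) ⟫ ψ-0) ⟫ ∑-const-ι1
                        ⟫ λ k → cong (λ n → ι (ℤ.+ n) k) (sym (ℕ.*-identityʳ size)))
      off-diagonal : ∀ b b' → b ≢ b' → ⟨ vec (V A a) b ∣ vec (V A a) b' ⟩ ≈ 0c
      off-diagonal b b' b≢b' =
        ≐-≈-trans {⟨ vec (V A a) b ∣ vec (V A a) b' ⟩} {∑ (ψ ∘ λ x → (b' + - b) * (x + a))} {0c}
                  (⟨V∣V⟩ a b a b' ⟫ ∑-cong (λ x → ψ-cong (phase-b'-phase-b a b b' x)))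
                  (∑ψ∘bijective≈0 (Bijection.bijective (↔⇒⤖ (*ˡ-↔ b'-b≢0 ↔-∘ +ʳ-↔ a))))
        where
        b'-b≢0 : b' + - b ≢ 0#
        b'-b≢0 b'-b≡0 = b≢b' (sym (x-y≡0⇒x≡y b' b b'-b≡0))

    E-V-unbiased : ∀ a → Unbiased E (V A a)
    E-V-unbiased a y b = ≐⇒≈ (⊛-congˡ (qℤ 1) (norm²-cong ⟨E∣ vec (V A a) b ⟩ ⟫ norm²-ψ (phase a b y)) ⟫ qℤ1⊛ι 1)

    V-E-unbiased : ∀ a → Unbiased (V A a) E
    V-E-unbiased a b y = ≐⇒≈ (⊛-congˡ (qℤ 1) (norm²-cong ⟨V∣E⟩ ⟫ norm²-ψ (0# + - phase a b y)) ⟫ qℤ1⊛ι 1)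
      where
      ⟨V∣E⟩ : ⟨ vec (V A a) b ∣ vec E y ⟩ ≐ ψ (0# + - phase a b y)
      ⟨V∣E⟩ = ⟨ vec (V A a) b ∣E⟩ ⟫ ⊛-congˡ (conj (ψ (phase a b y))) (≐-sym ψ-0) ⟫ conj-ψ-⊛-ψ (phase a b y) 0#

    module _ (a b a' b' : F) where
      phase-difference : F → F
      phase-difference x = phase a' b' x + - phase a b x

      Δ-phase-difference : ∀ d x → Δ phase-difference d x ≡ Δ (Δ A (a' + - a)) d (x + a) + (b' + - b) * d
      Δ-phase-difference d x = begin
        Δ phase-difference d x
          ≡⟨⟩
        expand (A ((x + d) + a')) (A ((x + d) + a)) (A (x + a')) (A (x + a))
          ≡⟨ cong₂ (λ α β → expand (A α) (A β) (A (x + a')) (A (x + a)))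
               (solve 4 (λ x d a a' → (x :+ d) :+ a' := ((x :+ a) :+ d) :+ (a' :+ :- a)) refl x d a a')
               (solve 3 (λ x d a → (x :+ d) :+ a := (x :+ a) :+ d) refl x d a) ⟩
        expand (A (((x + a) + d) + (a' + - a))) (A ((x + a) + d)) (A (x + a')) (A (x + a))
          ≡⟨ cong (λ γ → expand (A (((x + a) + d) + (a' + - a))) (A ((x + a) + d)) (A γ) (A (x + a)))
               (solve 3 (λ x a a' → x :+ a' := (x :+ a) :+ (a' :+ :- a)) refl x a a') ⟩
        expand (A (((x + a) + d) + (a' + - a))) (A ((x + a) + d)) (A ((x + a) + (a' + - a))) (A (x + a))
          ≡⟨ solve 10 (λ x d a a' b b' α β γ δ →
               ((α :+ b' :* ((x :+ d) :+ a')) :+ :- (β :+ b :* ((x :+ d) :+ a)))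
                 :+ :- ((γ :+ b' :* (x :+ a')) :+ :- (δ :+ b :* (x :+ a)))
               := ((α :+ :- β) :+ :- (γ :+ :- δ)) :+ (b' :+ :- b) :* d) refl x d a a' b b' _ _ _ _ ⟩
        Δ (Δ A (a' + - a)) d (x + a) + (b' + - b) * d
          ∎
        where
        open ≡-Reasoning
        expand : F → F → F → F → F
        expand α β γ δ = ((α + b' * ((x + d) + a')) + - (β + b * ((x + d) + a)))
                         + - ((γ + b' * (x + a')) + - (δ + b * (x + a)))

      phase-difference-planar : Alltop A → a ≢ a' → Planar phase-difference
      phase-difference-planar A-alltop a≢a' d d≢0 =
        Bijective-cong (λ x → sym (Δ-phase-difference d x))
          (affine-bijective a ((b' + - b) * d) (A-alltop (a' + - a) a'-a≢0 d d≢0))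
        where
        a'-a≢0 : a' + - a ≢ 0#
        a'-a≢0 a'-a≡0 = a≢a' (sym (x-y≡0⇒x≡y a' a a'-a≡0))

    V-V-unbiased : Alltop A → ∀ a a' → a ≢ a' → Unbiased (V A a) (V A a')
    V-V-unbiased A-alltop a a' a≢a' b b' =
      ≈-≐-trans {qℤ 1 ⊛ norm² inner} {qℤ 1 ⊛ ι (ℤ.+ size)} {qℤ 2} (ι-⊛-≈ (ℤ.+ (q ^ 1)) {norm² inner} {ι (ℤ.+ size)} norm²≈q)
        (qℤ1⊛ι size ⟫ λ k → cong (λ n → ι (ℤ.+ (q ℕ.* n)) k) (sym (ℕ.*-identityʳ q)))
      where
      inner : Cyc
      inner = ⟨ vec (V A a) b ∣ vec (V A a') b' ⟩
      norm²≈q : norm² inner ≈ ι (ℤ.+ size)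
      norm²≈q = ≐-≈-trans {norm² inner} {norm² (∑ (ψ ∘ phase-difference a b a' b'))} {ι (ℤ.+ size)}
                  (norm²-cong (⟨V∣V⟩ a b a' b'))
                  (planar⇒norm²∑ψ∘G≈q _ (phase-difference-planar a b a' b' A-alltop a≢a'))

  theorem : (A : F → F) → Alltop A →
            (∀ (i : Maybe F) → OrthonormalBasis (Family A i)) ×
            (∀ (i j : Maybe F) → i ≢ j → Unbiased (Family A i) (Family A j))
  theorem A A-alltop = orthonormal , unbiased
    where
    orthonormal : ∀ (i : Maybe F) → OrthonormalBasis (Family A i)
    orthonormal nothing  = E-orthonormal
    orthonormal (just a) = V-orthonormal A a
    unbiased : ∀ (i j : Maybe F) → i ≢ j → Unbiased (Family A i) (Family A j)
    unbiased nothing  nothing   i≢i   = ⊥-elim (i≢i refl)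
    unbiased nothing  (just a)  _     = E-V-unbiased A a
    unbiased (just a) nothing   _     = V-E-unbiased A a
    unbiased (just a) (just a') a≢a'  = V-V-unbiased A A-alltop a a' (a≢a' ∘ cong just)

theorem7 : (𝔽 : FiniteField) (p m : ℕ) {{_ : NonZero p}} →
    let open FiniteField 𝔽 in
    let open FF 𝔽 in
    let open Vectors p m in
    Prime p → 5 ≤ p → (p ·1) ≡ 0# → size ≡ p ^ m →
    (A : F → F) → Alltop A →
    (∀ (i : Maybe F) → OrthonormalBasis (Family A i)) ×
    (∀ (i j : Maybe F) → i ≢ j → Unbiased (Family A i) (Family A j))
theorem7 𝔽 p m p-prime _ char-p size≡pᵐ = MutuallyUnbiasedBases.theorem 𝔽 p m p-prime char-p size≡pᵐ
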